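{- Let $(X,d_X)$ be an ultrametric with associated rooted tree $T$, and let $A=\{x_1,\dots,x_l\}\subseteq X$, each point of $A$ corresponding to a distinct leaf of $T$. Then every HP-inward matching $M^{\mathrm{HPI}}$ on $A$ satisfies $\mathrm{Cost}(M^{\mathrm{HPI}})\le2\,\mathrm{Cost}(M^{\mathrm{OPT}})$, where $M^{\mathrm{OPT}}$ is a minimum-weight near-perfect matching on $A$.
   Context: The ultrametric is given as a 1-HST: a bijection $\varphi$ from $X$ to the leaves of a rooted tree $T$, with node labels $\Gamma\ge0$, $\Gamma=0$ on leaves, $\Gamma(v)\ge\Gamma(u)$ for each child $u$ of $v$, and $d_X(x,y)=\Gamma(\mathrm{lca}(\varphi(x),\varphi(y)))$. For a node $v$, $X_v$ is the set of points at the leaves of the subtree of $v$. The weight $w(v)$ of a node is the number of leaves in its subtree; an edge from parent $u$ to child $v$ is heavy if $w(v)>\frac12w(u)$, otherwise light. The heavy edges form vertex-disjoint descending paths (heavy paths; single nodes not incident to heavy edges form trivial paths), together partitioning the nodes of $T$. A matching $M$ on $A$ is HP-inward if for every heavy path $P=(u_1,\dots,u_m)$, with $u_1$ the node of $P$ closest to the root: (1) at most one point of $X_{u_1}\cap A$ is matched to a point outside $X_{u_1}$ (and this happens if and only if $|X_{u_1}\cap A|$ is odd); and (2) if a point $p\in X_{u_1}\cap A$ is matched to a point outside $X_{u_1}$, then $p\in X_{u_1}\setminus X_{u_{i^*}}$ for the minimum integer $i^*\ge2$ such that $|(X_{u_1}\setminus X_{u_{i^*}})\cap A|$ is odd (with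 $X_{u_{m+1}}:=\emptyset$). A near-perfect matching covers all but at most one point; $\mathrm{Cost}$ is the sum of $d_X$ over edges.
   Formalization: The node labels Γ of the tree T, and so the distances $d_X$ and the costs of matchings, take values in the nonnegative rationals. -}

module Defs where

open import Data.Nat as ℕ using (ℕ; zero; suc; _<ᵇ_; _%_; _≤_; _<_)
open import Data.Bool using (Bool; true; false; _∧_; not; if_then_else_)
open import Data.List using (List; []; _∷_; _++_; length; filterᵇ; foldr)
open import Data.List.Relation.Unary.All using (All)
open import Data.List.Relation.Unary.Unique.Propositional using (Unique)
open import Data.List.Membership.Propositional using (_∈_; _∉_)
open import Data.Maybe using (Maybe; just; nothing; maybe; _>>=_)
open import Data.Product using (Σ; ∃; _×_; _,_)
open import Data.Sum using (_⊎_)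
open import Data.Rational as ℚ using (ℚ; 0ℚ)
open import Relation.Binary.PropositionalEquality using (_≡_; _≢_)
open import Relation.Nullary using (¬_)

-- Rooted trees (1-HSTs).  Leaves are `leaf` (label Γ = 0); an internal
-- node carries its label Γ ∈ ℚ and its ordered list of children.

data Tree : Set where
  leaf : Tree
  node : ℚ → List Tree → Tree

label : Tree → ℚ
label leaf = 0ℚ
label (node g _) = g

-- validity of a 1-HST: Γ ≥ 0, Γ(v) ≥ Γ(u) for each child u of v,
-- internal nodes have at least one child (so leaves are exactly `leaf`).
data ValidHST : Tree → Set where
  leafV : ValidHST leaf
  nodeV : ∀ {g ts} → ℚ._≤_ 0ℚ g → 1 ≤ length ts
        → All (λ c → ℚ._≤_ (label c) g) ts → All ValidHST ts
        → ValidHST (node g ts)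

-- Nodes of T are addressed by the list of child indices from the root.
Address : Set
Address = List ℕ

nth : {A : Set} → List A → ℕ → Maybe A
nth [] _ = nothing
nth (x ∷ xs) zero = just x
nth (x ∷ xs) (suc i) = nth xs i

subtreeAt : Tree → Address → Maybe Tree
subtreeAt t [] = just t
subtreeAt leaf (i ∷ p) = nothing
subtreeAt (node g ts) (i ∷ p) with nth ts i
... | nothing = nothing
... | just c = subtreeAt c p

IsNode : Tree → Address → Set
IsNode T v = ∃ λ t → subtreeAt T v ≡ just t

-- points of X are identified (via the bijection φ) with the leaves of T
IsPoint : Tree → Address → Set
IsPoint T p = subtreeAt T p ≡ just leaf

-- prefix test: p lies in the subtree of v  (i.e. the point p ∈ X_v)
_≼ᵇ_ : Address → Address → Bool
[] ≼ᵇ q = true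
(i ∷ v) ≼ᵇ [] = false
(i ∷ v) ≼ᵇ (j ∷ q) = (i ℕ.≡ᵇ j) ∧ (v ≼ᵇ q)

lca : Address → Address → Address
lca [] q = []
lca (i ∷ p) [] = []
lca (i ∷ p) (j ∷ q) = if i ℕ.≡ᵇ j then i ∷ lca p q else []

-- d_X(x,y) = Γ(lca(φ x, φ y))
dist : Tree → Address → Address → ℚ
dist T p q = maybe label 0ℚ (subtreeAt T (lca p q))

mutual
  weight : Tree → ℕ
  weight leaf = 1
  weight (node g ts) = weights ts

  weights : List Tree → ℕ
  weights [] = 0
  weights (t ∷ ts) = weight t ℕ.+ weights ts

HeavyEdge : Tree → Address → Address → Set
HeavyEdge T u v = Σ ℕ λ i → v ≡ u ++ (i ∷ []) × Σ Tree λ tu → Σ Tree λ tv →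
  subtreeAt T u ≡ just tu × subtreeAt T v ≡ just tv × weight tu < 2 ℕ.* weight tv

findHeavy : ℕ → ℕ → List Tree → Maybe ℕ
findHeavy W k [] = nothing
findHeavy W k (c ∷ cs) = if W <ᵇ (2 ℕ.* weight c) then just k else findHeavy W (suc k) cs

-- the (unique, since > half) heavy child of node u, if any
heavyStep : Tree → Address → Maybe Address
heavyStep T u with subtreeAt T u
... | just (node g ts) = Data.Maybe.map (λ i → u ++ (i ∷ [])) (findHeavy (weights ts) 0 ts)
... | _ = nothing

IsHPTop : Tree → Address → Set
IsHPTop T u = IsNode T u × ¬ (∃ λ u' → HeavyEdge T u' u)

-- heavy path nodes from a top u1, 0-based:  hp T u1 k = u_{k+1};
-- `nothing` once past the end u_m (so X_{u_{m+1}} = ∅, etc.)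
hp : Tree → Address → ℕ → Maybe Address
hp T u zero = just u
hp T u (suc k) = hp T u k >>= heavyStep T

inX : Maybe Address → Address → Bool
inX nothing p = false
inX (just v) p = v ≼ᵇ p

Matching : Set
Matching = List (Address × Address)

endpoints : Matching → List Address
endpoints [] = []
endpoints ((p , q) ∷ M) = p ∷ q ∷ endpoints M

IsMatching : List Address → Matching → Set
IsMatching A M = All (λ e → Σ Address λ p → Σ Address λ q →
                       e ≡ (p , q) × p ∈ A × q ∈ A × p ≢ q) M
               × Unique (endpoints M)

IsNearPerfect : List Address → Matching → Set
IsNearPerfect A M = IsMatching A M ×
  (∀ p q → p ∈ A → q ∈ A → p ∉ endpoints M → q ∉ endpoints M → p ≡ q)

Cost : Tree → Matching → ℚ
Cost T M = foldr (λ e c → dist T (Data.Product.proj₁ e) (Data.Product.proj₂ e) ℚ.+ c) 0ℚ M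

IsOptNearPerfect : Tree → List Address → Matching → Set
IsOptNearPerfect T A M = IsNearPerfect A M ×
  (∀ M' → IsNearPerfect A M' → ℚ._≤_ (Cost T M) (Cost T M'))

count : (Address → Bool) → List Address → ℕ
count f A = length (filterᵇ f A)

Odd : ℕ → Set
Odd n = n % 2 ≡ 1

-- p ∈ X_v ∩ A is "matched to a point outside X_v": it is not matched to
-- any point of X_v (an unmatched point counts as matched outside).
MatchedOutside : List Address → Matching → Address → Address → Set
MatchedOutside A M v p = p ∈ A × (v ≼ᵇ p) ≡ true ×
  ¬ (∃ λ q → ((p , q) ∈ M ⊎ (q , p) ∈ M) × (v ≼ᵇ q) ≡ true)

diffCount : Tree → List Address → Address → ℕ → ℕ
diffCount T A u k = count (λ a → (u ≼ᵇ a) ∧ not (inX (hp T u k) a)) A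

-- k (0-based) is i* - 1, i.e. i* = k+1 is the least i* ≥ 2 with odd count
IsIStar : Tree → List Address → Address → ℕ → Set
IsIStar T A u k = 1 ≤ k × Odd (diffCount T A u k) ×
  (∀ j → 1 ≤ j → j < k → ¬ Odd (diffCount T A u j))

HPInward : Tree → List Address → Matching → Set
HPInward T A M = IsMatching A M × (∀ u → IsHPTop T u →
    (∀ p q → MatchedOutside A M u p → MatchedOutside A M u q → p ≡ q)
  × ((∃ λ p → MatchedOutside A M u p) → Odd (count (u ≼ᵇ_) A))
  × (Odd (count (u ≼ᵇ_) A) → ∃ λ p → MatchedOutside A M u p)
  × (∀ p → MatchedOutside A M u p → ∀ k → IsIStar T A u k →
       inX (hp T u k) p ≡ false))

-- Let s be the point of A that Mopt leaves unmatched (if any), and for a node u with parent v let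
-- δ(u) = Γ(v) − Γ(u) ≥ 0. Both costs are compared with Φ, the sum of δ(u) over the nodes u for which
-- |X_u ∩ A ∖ {s}| is odd.
--
-- Lower bound: each such X_u is left by an edge of Mopt. An edge whose endpoints meet at v leaves every
-- X_u on the two descending paths to its endpoints, and the δ's on each path telescope to Γ(v), so
-- Φ ≤ 2 Cost(Mopt).
--
-- Upper bound, by induction over the tree: an edge of M whose endpoints meet at v has an endpoint in a
-- light child of v, where a new heavy path starts, and is paid there. If the top u₁ of a heavy path has
-- odd |X_{u₁} ∩ A|, its single point matched outside leaves the path above u_{i*}. All of u₂, …, u_{i*−1}
-- then have odd |X_{u_i} ∩ A|, so the δ's along the path pay Γ(u₁) down to the node where that point
-- leaves. The parities with and without s differ exactly on the ancestors of s, and this difference is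
-- absorbed at each node. Hence Cost(M) ≤ Φ.

module Submission where

open import Defs
open import Algebra.Bundles using (CommutativeSemigroup)
open import Algebra.Structures using (IsCommutativeMonoid)
open import Data.Bool using (Bool; true; false; _∧_; _∨_; not; if_then_else_; _xor_; T)
open import Data.Bool.ListAction using (any)
open import Data.Bool.Properties
  using (∧-zeroʳ; ∧-identityʳ; ∧-idem; ∧-conicalˡ; ∧-conicalʳ; ∧-distribˡ-∨; ∨-zeroʳ; ∨-assoc; not-involutive; xor-identityʳ)
open import Data.Empty using (⊥-elim)
open import Data.List using (List; []; _∷_; _++_; length; filterᵇ; findᵇ)
open import Data.List.Properties using (≡-dec; ++-identityʳ; ++-assoc; ∷-injective; ∷ʳ-injective)
open import Data.List.Membership.Propositional using (_∈_; _∉_)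
open import Data.List.Relation.Unary.All as All using (All; []; _∷_)
open import Data.List.Relation.Unary.AllPairs as AllPairs using (_∷_)
open import Data.List.Relation.Unary.Any using (here; there)
open import Data.List.Relation.Unary.Unique.Propositional using (Unique)
open import Data.Maybe using (Maybe; just; nothing; maybe)
open import Data.Maybe.Properties using (just-injective)
open import Data.Nat as ℕ using (ℕ; zero; suc; z≤n; s≤s; _≡ᵇ_; _<ᵇ_; _⊔_; _%_)
import Data.Nat.Properties as ℕP
open import Data.Product using (∃; _×_; _,_; proj₁; proj₂)
open import Data.Rational as ℚ using (ℚ; 0ℚ; _≤_; _+_; _-_)
import Data.Rational.Properties as ℚP
open import Algebra.Properties.Group ℚP.+-0-group using (∙-cancelʳ)
open import Data.Rational.Solver using (module +-*-Solver)
open import Data.Sum using (_⊎_; inj₁; inj₂)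
open import Data.Unit using (tt)
open import Function using (case_of_; _∘_)
open import Level using (0ℓ)
open import Relation.Binary.PropositionalEquality
open import Relation.Nullary using (¬_; Dec; yes; no; does)
open import Relation.Nullary.Decidable using (dec-true; dec-false; does-≡; map′)

does⇒ : {P : Set} (p? : Dec P) → does p? ≡ true → P
does⇒ (yes p) _ = p

_≟ᴬ_ : (p q : Address) → Dec (p ≡ q)
_≟ᴬ_ = ≡-dec ℕP._≟_

_==ᴬ_ : Address → Address → Bool
p ==ᴬ q = does (p ≟ᴬ q)

==ᴬ-refl : ∀ p → (p ==ᴬ p) ≡ true
==ᴬ-refl p = dec-true (p ≟ᴬ p) refl

==ᴬ-sym : ∀ p q → (p ==ᴬ q) ≡ (q ==ᴬ p)
==ᴬ-sym p q = does-≡ (p ≟ᴬ q) (map′ sym sym (q ≟ᴬ p))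

≡ᵇ-refl : ∀ i → (i ≡ᵇ i) ≡ true
≡ᵇ-refl i = dec-true (i ℕP.≟ i) refl

≡ᵇ-≢ : ∀ {i j} → i ≢ j → (i ≡ᵇ j) ≡ false
≡ᵇ-≢ {i} {j} = dec-false (i ℕP.≟ j)

≼ᵇ-++ : ∀ v w → (v ≼ᵇ (v ++ w)) ≡ true
≼ᵇ-++ [] w = refl
≼ᵇ-++ (i ∷ v) w rewrite ≡ᵇ-refl i = ≼ᵇ-++ v w

≼ᵇ-refl : ∀ v → (v ≼ᵇ v) ≡ true
≼ᵇ-refl v = subst (λ p → (v ≼ᵇ p) ≡ true) (++-identityʳ v) (≼ᵇ-++ v [])

≼ᵇ⇒++ : ∀ v p → (v ≼ᵇ p) ≡ true → ∃ λ w → p ≡ v ++ w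
≼ᵇ⇒++ [] p _ = p , refl
≼ᵇ⇒++ (i ∷ v) (j ∷ p) h with i ≡ᵇ j in i≡ᵇj
... | true = let w , p≡v++w = ≼ᵇ⇒++ v p h in w , cong₂ _∷_ (sym (does⇒ (i ℕP.≟ j) i≡ᵇj)) p≡v++w

++-≼ᵇ-++ : ∀ v x y → ((v ++ x) ≼ᵇ (v ++ y)) ≡ (x ≼ᵇ y)
++-≼ᵇ-++ [] x y = refl
++-≼ᵇ-++ (i ∷ v) x y rewrite ≡ᵇ-refl i = ++-≼ᵇ-++ v x y

≼ᵇ-trans : ∀ u v p → (u ≼ᵇ v) ≡ true → (v ≼ᵇ p) ≡ true → (u ≼ᵇ p) ≡ true
≼ᵇ-trans u v p u≼v v≼p with ≼ᵇ⇒++ u v u≼v | ≼ᵇ⇒++ v p v≼p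
... | x , refl | y , refl rewrite ++-assoc u x y = ≼ᵇ-++ u (x ++ y)

child : Address → ℕ → Address
child v i = v ++ (i ∷ [])

child-≼ᵇ : ∀ v j i w → (child v j ≼ᵇ (v ++ (i ∷ w))) ≡ (j ≡ᵇ i)
child-≼ᵇ v j i w rewrite ++-≼ᵇ-++ v (j ∷ []) (i ∷ w) = ∧-identityʳ (j ≡ᵇ i)

child-⋠ᵇ : ∀ v j p → (v ≼ᵇ p) ≡ false → (child v j ≼ᵇ p) ≡ false
child-⋠ᵇ v j p v⋠p with child v j ≼ᵇ p in vj≼p
... | false = refl
... | true = trans (sym (≼ᵇ-trans v (child v j) p (≼ᵇ-++ v (j ∷ [])) vj≼p)) v⋠p

++-∷-≢ : ∀ (v : Address) i w → v ++ (i ∷ w) ≢ v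
++-∷-≢ (x ∷ v) i w eq = ++-∷-≢ v i w (proj₂ (∷-injective eq))

lca-++ : ∀ v x y → lca (v ++ x) (v ++ y) ≡ v ++ lca x y
lca-++ [] x y = refl
lca-++ (i ∷ v) x y rewrite ≡ᵇ-refl i = cong (i ∷_) (lca-++ v x y)

lca-≢ : ∀ {i j} x y → i ≢ j → lca (i ∷ x) (j ∷ y) ≡ []
lca-≢ x y i≢j rewrite ≡ᵇ-≢ i≢j = refl

lca-refl : ∀ p → lca p p ≡ p
lca-refl [] = refl
lca-refl (i ∷ p) rewrite ≡ᵇ-refl i = cong (i ∷_) (lca-refl p)

subtreeAt-++ : ∀ t v w {s} → subtreeAt t v ≡ just s → subtreeAt t (v ++ w) ≡ subtreeAt s w
subtreeAt-++ t [] w refl = refl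
subtreeAt-++ (node g ts) (i ∷ v) w h with nth ts i
... | just c = subtreeAt-++ c v w h

subtreeAt-child : ∀ T v {g ts} i {c} → subtreeAt T v ≡ just (node g ts) → nth ts i ≡ just c →
  subtreeAt T (child v i) ≡ just c
subtreeAt-child T v i hv hc rewrite subtreeAt-++ T v (i ∷ []) hv | hc = refl

nth⇒< : {A : Set} (xs : List A) (i : ℕ) {x : A} → nth xs i ≡ just x → i ℕ.< length xs
nth⇒< (_ ∷ _) zero _ = s≤s z≤n
nth⇒< (_ ∷ xs) (suc i) h = s≤s (nth⇒< xs i h)

nth⇒∈ : {A : Set} (xs : List A) (i : ℕ) {x : A} → nth xs i ≡ just x → x ∈ xs
nth⇒∈ (_ ∷ _) zero refl = here refl
nth⇒∈ (_ ∷ xs) (suc i) h = there (nth⇒∈ xs i h)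

point-below-node : ∀ T v {g ts} p → subtreeAt T v ≡ just (node g ts) → IsPoint T p → (v ≼ᵇ p) ≡ true →
  ∃ λ i → ∃ λ w → ∃ λ c → p ≡ v ++ (i ∷ w) × nth ts i ≡ just c
point-below-node T v {g} {ts} p hv hp v≼p with ≼ᵇ⇒++ v p v≼p
... | [] , refl with () ← trans (sym hv) (trans (cong (subtreeAt T) (sym (++-identityʳ v))) hp)
... | (i ∷ w) , refl with nth ts i in hc | trans (sym (subtreeAt-++ T v (i ∷ w) hv)) hp
... | just c | _ = i , w , c , refl , hc

point-below-leaf : ∀ T v p → subtreeAt T v ≡ just leaf → IsPoint T p → (v ≼ᵇ p) ≡ true → p ≡ v
point-below-leaf T v p hv hp v≼p with ≼ᵇ⇒++ v p v≼p
... | [] , refl = ++-identityʳ v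
... | (i ∷ w) , refl with () ← trans (sym (subtreeAt-++ T v (i ∷ w) hv)) hp

insideᵇ : Address → Address × Address → Bool
insideᵇ v (p , q) = (v ≼ᵇ p) ∧ (v ≼ᵇ q)

partnerInsideᵇ : Matching → Address → Address → Bool
partnerInsideᵇ X v p = any (λ (a , b) → ((a ==ᴬ p) ∧ (v ≼ᵇ b)) ∨ ((b ==ᴬ p) ∧ (v ≼ᵇ a))) X

matchedOutsideᵇ : Matching → Address → Address → Bool
matchedOutsideᵇ X v p = (v ≼ᵇ p) ∧ not (partnerInsideᵇ X v p)

insideEndpoints : Matching → Address → List Address
insideEndpoints X v = endpoints (filterᵇ (insideᵇ v) X)

memberᵇ : Address → List Address → Bool
memberᵇ p = any (_==ᴬ p)

any-complete : {X : Set} (f : X → Bool) (xs : List X) {x : X} → x ∈ xs → f x ≡ true → any f xs ≡ true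
any-complete f (y ∷ xs) (here refl) fx rewrite fx = refl
any-complete f (y ∷ xs) (there x∈xs) fx with f y
... | true = refl
... | false = any-complete f xs x∈xs fx

any-sound : {X : Set} (f : X → Bool) (xs : List X) → any f xs ≡ true → ∃ λ x → x ∈ xs × f x ≡ true
any-sound f (y ∷ xs) h with f y in fy
... | true = y , here refl , fy
... | false = let x , x∈xs , fx = any-sound f xs h in x , there x∈xs , fx

∨-true : ∀ a {b} → (a ∨ b) ≡ true → a ≡ true ⊎ b ≡ true
∨-true true _ = inj₁ refl
∨-true false h = inj₂ h

filterᵇ-∷ : {X : Set} (f : X → Bool) (x : X) (xs : List X) →
  filterᵇ f (x ∷ xs) ≡ (if f x then x ∷ filterᵇ f xs else filterᵇ f xs)
filterᵇ-∷ f x xs with f x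
... | true = refl
... | false = refl

matchedOutside⇒ᵇ : ∀ A X v p → MatchedOutside A X v p → matchedOutsideᵇ X v p ≡ true
matchedOutside⇒ᵇ A X v p (_ , v≼p , noPartner) rewrite v≼p with partnerInsideᵇ X v p in partner
... | false = refl
... | true with any-sound _ X partner
... | (a , b) , ab∈X , found with ∨-true ((a ==ᴬ p) ∧ (v ≼ᵇ b)) found
...   | inj₁ h = ⊥-elim (noPartner (b , inj₁ (subst (λ z → (z , b) ∈ X) (does⇒ (a ≟ᴬ p) (∧-conicalˡ _ _ h)) ab∈X) ,
                                     ∧-conicalʳ _ _ h))
...   | inj₂ h = ⊥-elim (noPartner (a , inj₂ (subst (λ z → (a , z) ∈ X) (does⇒ (b ≟ᴬ p) (∧-conicalˡ _ _ h)) ab∈X) ,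
                                     ∧-conicalʳ _ _ h))

ᵇ⇒matchedOutside : ∀ A X v p → p ∈ A → matchedOutsideᵇ X v p ≡ true → MatchedOutside A X v p
ᵇ⇒matchedOutside A X v p p∈A h = p∈A , ∧-conicalˡ _ _ h , noPartner
  where
    partner≢true : partnerInsideᵇ X v p ≢ true
    partner≢true t with () ← trans (sym (∧-conicalʳ (v ≼ᵇ p) _ h)) (cong not t)
    noPartner : ¬ (∃ λ q → ((p , q) ∈ X ⊎ (q , p) ∈ X) × (v ≼ᵇ q) ≡ true)
    noPartner (q , inj₁ pq∈X , v≼q) = partner≢true (any-complete _ X pq∈X
      (cong (_∨ ((q ==ᴬ p) ∧ (v ≼ᵇ p))) (trans (cong (_∧ (v ≼ᵇ q)) (==ᴬ-refl p)) v≼q)))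
    noPartner (q , inj₂ qp∈X , v≼q) = partner≢true (any-complete _ X qp∈X
      (trans (cong (((q ==ᴬ p) ∧ (v ≼ᵇ p)) ∨_) (trans (cong (_∧ (v ≼ᵇ q)) (==ᴬ-refl p)) v≼q)) (∨-zeroʳ _)))

partnerEdge-member : ∀ v a b p →
  ((v ≼ᵇ p) ∧ (((a ==ᴬ p) ∧ (v ≼ᵇ b)) ∨ ((b ==ᴬ p) ∧ (v ≼ᵇ a))))
    ≡ (insideᵇ v (a , b) ∧ ((a ==ᴬ p) ∨ (b ==ᴬ p)))
partnerEdge-member v a b p with a ≟ᴬ p | b ≟ᴬ p
... | no _ | no _ = trans (∧-zeroʳ _) (sym (∧-zeroʳ _))
... | yes refl | yes refl with v ≼ᵇ a
...   | true = refl
...   | false = refl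
partnerEdge-member v a b p | yes refl | no _ with v ≼ᵇ a | v ≼ᵇ b
...   | true | true = refl
...   | true | false = refl
...   | false | _ = refl
partnerEdge-member v a b p | no _ | yes refl with v ≼ᵇ a | v ≼ᵇ b
...   | true | true = refl
...   | false | true = refl
...   | true | false = refl
...   | false | false = refl

partnerInside-member : ∀ X v p → ((v ≼ᵇ p) ∧ partnerInsideᵇ X v p) ≡ memberᵇ p (insideEndpoints X v)
partnerInside-member [] v p = ∧-zeroʳ (v ≼ᵇ p)
partnerInside-member ((a , b) ∷ X) v p
  rewrite ∧-distribˡ-∨ (v ≼ᵇ p) (((a ==ᴬ p) ∧ (v ≼ᵇ b)) ∨ ((b ==ᴬ p) ∧ (v ≼ᵇ a))) (partnerInsideᵇ X v p)
        | partnerEdge-member v a b p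
        | partnerInside-member X v p
        | filterᵇ-∷ (insideᵇ v) (a , b) X
  with insideᵇ v (a , b)
... | true = ∨-assoc (a ==ᴬ p) (b ==ᴬ p) (memberᵇ p (insideEndpoints X v))
... | false = refl

All-insideEndpoints : ∀ {P : Address → Set} X v → All P (endpoints X) → All P (insideEndpoints X v)
All-insideEndpoints [] v _ = []
All-insideEndpoints ((a , b) ∷ X) v (Pa ∷ Pb ∷ Ps) rewrite filterᵇ-∷ (insideᵇ v) (a , b) X with insideᵇ v (a , b)
... | true = Pa ∷ Pb ∷ All-insideEndpoints X v Ps
... | false = All-insideEndpoints X v Ps

Unique-insideEndpoints : ∀ X v → Unique (endpoints X) → Unique (insideEndpoints X v)
Unique-insideEndpoints [] v _ = AllPairs.[]
Unique-insideEndpoints ((a , b) ∷ X) v ((a∉ ∷ a∉X) ∷ b∉X ∷ u)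
  rewrite filterᵇ-∷ (insideᵇ v) (a , b) X with insideᵇ v (a , b)
... | true = (a∉ ∷ All-insideEndpoints X v a∉X) ∷ All-insideEndpoints X v b∉X ∷ Unique-insideEndpoints X v u
... | false = Unique-insideEndpoints X v u

endpoints-∈ : ∀ A X → IsMatching A X → All (_∈ A) (endpoints X)
endpoints-∈ A [] _ = []
endpoints-∈ A (_ ∷ X) ((_ , _ , refl , p∈A , q∈A , _) ∷ edges , _ ∷ _ ∷ u) = p∈A ∷ q∈A ∷ endpoints-∈ A X (edges , u)

module IndicatorSums {C : Set} {_⊕_ : C → C → C} {ε : C} (isCM : IsCommutativeMonoid _≡_ _⊕_ ε) where

  open IsCommutativeMonoid isCM using (assoc; identityˡ; identityʳ; isCommutativeSemigroup)

  private
    semigroup : CommutativeSemigroup 0ℓ 0ℓ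
    semigroup = record { isCommutativeSemigroup = isCommutativeSemigroup }

  open import Algebra.Properties.CommutativeSemigroup semigroup using (interchange)

  infixr 30 [_]·_
  [_]·_ : Bool → C → C
  [ true ]· x = x
  [ false ]· x = ε

  sum : {X : Set} → (X → C) → List X → C
  sum f [] = ε
  sum f (x ∷ xs) = f x ⊕ sum f xs

  sumFrom : {X : Set} → (ℕ → X → C) → ℕ → List X → C
  sumFrom f k [] = ε
  sumFrom f k (x ∷ xs) = f k x ⊕ sumFrom f (suc k) xs

  sum-⊕ : {X : Set} (f g : X → C) (xs : List X) → sum (λ x → f x ⊕ g x) xs ≡ sum f xs ⊕ sum g xs
  sum-⊕ f g [] = sym (identityˡ ε)
  sum-⊕ f g (x ∷ xs) = trans (cong ((f x ⊕ g x) ⊕_) (sum-⊕ f g xs)) (interchange (f x) (g x) (sum f xs) (sum g xs))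

  sumFrom-⊕ : {X : Set} (f g : ℕ → X → C) (k : ℕ) (xs : List X) →
    sumFrom (λ i x → f i x ⊕ g i x) k xs ≡ sumFrom f k xs ⊕ sumFrom g k xs
  sumFrom-⊕ f g k [] = sym (identityˡ ε)
  sumFrom-⊕ f g k (x ∷ xs) =
    trans (cong ((f k x ⊕ g k x) ⊕_) (sumFrom-⊕ f g (suc k) xs))
          (interchange (f k x) (g k x) (sumFrom f (suc k) xs) (sumFrom g (suc k) xs))

  sum-cong : {X : Set} {f g : X → C} (xs : List X) → (∀ x → f x ≡ g x) → sum f xs ≡ sum g xs
  sum-cong [] _ = refl
  sum-cong (x ∷ xs) f≗g = cong₂ _⊕_ (f≗g x) (sum-cong xs f≗g)

  sum-cong-All : {X : Set} {f g : X → C} (xs : List X) → All (λ x → f x ≡ g x) xs → sum f xs ≡ sum g xs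
  sum-cong-All [] [] = refl
  sum-cong-All (x ∷ xs) (fx≡gx ∷ f≗g) = cong₂ _⊕_ fx≡gx (sum-cong-All xs f≗g)

  sumFrom-cong : {X : Set} {f g : ℕ → X → C} (k : ℕ) (xs : List X) → (∀ i x → f i x ≡ g i x) →
    sumFrom f k xs ≡ sumFrom g k xs
  sumFrom-cong k [] _ = refl
  sumFrom-cong k (x ∷ xs) f≗g = cong₂ _⊕_ (f≗g k x) (sumFrom-cong (suc k) xs f≗g)

  sum-ε : {X : Set} {f : X → C} (xs : List X) → All (λ x → f x ≡ ε) xs → sum f xs ≡ ε
  sum-ε [] [] = refl
  sum-ε (x ∷ xs) (fx≡ε ∷ f≗ε) rewrite fx≡ε | sum-ε xs f≗ε = identityˡ ε

  sumFrom-ε≥ : {X : Set} {f : ℕ → X → C} (k : ℕ) (xs : List X) → (∀ i x → k ℕ.≤ i → f i x ≡ ε) →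
    sumFrom f k xs ≡ ε
  sumFrom-ε≥ k [] _ = refl
  sumFrom-ε≥ {f = f} k (x ∷ xs) f≗ε
    rewrite f≗ε k x ℕP.≤-refl | sumFrom-ε≥ {f = f} (suc k) xs (λ i y k<i → f≗ε i y (ℕP.<⇒≤ k<i)) = identityˡ ε

  sumFrom-ε : {X : Set} {f : ℕ → X → C} (k : ℕ) (xs : List X) → (∀ i x → f i x ≡ ε) → sumFrom f k xs ≡ ε
  sumFrom-ε k xs f≗ε = sumFrom-ε≥ k xs (λ i x _ → f≗ε i x)

  sum-sumFrom : {X Y : Set} (f : ℕ → X → Y → C) (k : ℕ) (xs : List X) (ys : List Y) →
    sum (λ y → sumFrom (λ i x → f i x y) k xs) ys ≡ sumFrom (λ i x → sum (f i x) ys) k xs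
  sum-sumFrom f k xs [] = sym (sumFrom-ε k xs (λ _ _ → refl))
  sum-sumFrom f k xs (y ∷ ys) =
    trans (cong (sumFrom (λ i x → f i x y) k xs ⊕_) (sum-sumFrom f k xs ys))
          (sym (sumFrom-⊕ (λ i x → f i x y) (λ i x → sum (f i x) ys) k xs))

  sumFrom-single : {X : Set} (c : C) (i k : ℕ) (xs : List X) → k ℕ.≤ i → i ℕ.< k ℕ.+ length xs →
    sumFrom (λ j _ → [ j ≡ᵇ i ]· c) k xs ≡ c
  sumFrom-single c i k [] k≤i i<k rewrite ℕP.+-identityʳ k = ⊥-elim (ℕP.<⇒≱ i<k k≤i)
  sumFrom-single c i k (x ∷ xs) k≤i i<k+1+n with k ℕP.≟ i
  ... | yes refl rewrite ≡ᵇ-refl k = trans (cong (c ⊕_) (sumFrom-ε≥ (suc k) xs rest)) (identityʳ c)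
    where rest : ∀ j y → suc k ℕ.≤ j → [ j ≡ᵇ k ]· c ≡ ε
          rest j _ k<j rewrite ≡ᵇ-≢ (ℕP.>⇒≢ k<j) = refl
  ... | no k≢i rewrite ≡ᵇ-≢ k≢i =
    trans (identityˡ _) (sumFrom-single c i (suc k) xs (ℕP.≤∧≢⇒< k≤i k≢i) (subst (i ℕ.<_) (ℕP.+-suc k (length xs)) i<k+1+n))

  sumFrom-nth : {X : Set} (c : C) (xs : List X) (i : ℕ) {x : X} → nth xs i ≡ just x →
    sumFrom (λ j _ → [ j ≡ᵇ i ]· c) 0 xs ≡ c
  sumFrom-nth c xs i x∈xs = sumFrom-single c i 0 xs z≤n (nth⇒< xs i x∈xs)

  [∨]· : ∀ a b (x : C) → (a ∧ b) ≡ false → [ a ∨ b ]· x ≡ [ a ]· x ⊕ [ b ]· x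
  [∨]· true false x _ = sym (identityʳ x)
  [∨]· false b x _ = sym (identityˡ _)

  []·-ε : ∀ b → [ b ]· ε ≡ ε
  []·-ε true = refl
  []·-ε false = refl

  []·-⊕ : ∀ b (x y : C) → [ b ]· (x ⊕ y) ≡ [ b ]· x ⊕ [ b ]· y
  []·-⊕ true x y = refl
  []·-⊕ false x y = sym (identityˡ ε)

  [∧]· : ∀ a b (x : C) → [ a ∧ b ]· x ≡ [ a ]· [ b ]· x
  [∧]· true b x = refl
  [∧]· false b x = refl

  []·-comm : ∀ a b (x : C) → [ a ]· [ b ]· x ≡ [ b ]· [ a ]· x
  []·-comm true b x = refl
  []·-comm false true x = refl
  []·-comm false false x = refl

  [∧¬]·⊕[∧]· : ∀ a b (x : C) → [ a ]· x ≡ [ a ∧ not b ]· x ⊕ [ a ∧ b ]· x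
  [∧¬]·⊕[∧]· true true x = sym (identityˡ x)
  [∧¬]·⊕[∧]· true false x = sym (identityʳ x)
  [∧¬]·⊕[∧]· false b x = sym (identityˡ ε)

  sum-pick : ∀ (F : Address → C) (k : Address) (A : List Address) → Unique A → k ∈ A → sum (λ p → [ k ==ᴬ p ]· F p) A ≡ F k
  sum-pick F k (a ∷ A) (k∉A ∷ u) (here refl) rewrite ==ᴬ-refl k =
    trans (cong (F k ⊕_) (sum-ε A (All.map (λ k≢p → cong ([_]· _) (dec-false (k ≟ᴬ _) k≢p)) k∉A))) (identityʳ (F k))
  sum-pick F k (a ∷ A) (a∉A ∷ u) (there k∈A) rewrite dec-false (k ≟ᴬ a) (λ k≡a → All.lookup a∉A k∈A (sym k≡a)) =
    trans (identityˡ _) (sum-pick F k A u k∈A)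

  sum-member : ∀ (F : Address → C) (A K : List Address) → Unique A → Unique K → All (_∈ A) K →
    sum (λ p → [ memberᵇ p K ]· F p) A ≡ sum F K
  sum-member F A [] _ _ _ = sum-ε A (All.tabulate (λ _ → refl))
  sum-member F A (k ∷ K) uA (k∉K ∷ uK) (k∈A ∷ K⊆A) = begin
      sum (λ p → [ (k ==ᴬ p) ∨ memberᵇ p K ]· F p) A
    ≡⟨ sum-cong A (λ p → [∨]· (k ==ᴬ p) (memberᵇ p K) (F p) (disjoint p)) ⟩
      sum (λ p → [ k ==ᴬ p ]· F p ⊕ [ memberᵇ p K ]· F p) A
    ≡⟨ sum-⊕ _ _ A ⟩
      sum (λ p → [ k ==ᴬ p ]· F p) A ⊕ sum (λ p → [ memberᵇ p K ]· F p) A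
    ≡⟨ cong₂ _⊕_ (sum-pick F k A uA k∈A) (sum-member F A K uA uK K⊆A) ⟩
      F k ⊕ sum F K ∎
    where
      open ≡-Reasoning
      disjoint : ∀ p → ((k ==ᴬ p) ∧ memberᵇ p K) ≡ false
      disjoint p with k ≟ᴬ p | memberᵇ p K in p∈ᵇK
      ... | no _ | _ = refl
      ... | yes _ | false = refl
      ... | yes refl | true = let q , q∈K , q≡k = any-sound _ K p∈ᵇK in
                              ⊥-elim (All.lookup k∉K q∈K (sym (does⇒ (q ≟ᴬ k) q≡k)))

  sum-insideEndpoints : ∀ (F : Address → C) (X : Matching) (v : Address) →
    sum F (insideEndpoints X v) ≡ sum (λ e → [ insideᵇ v e ]· (F (proj₁ e) ⊕ F (proj₂ e))) X
  sum-insideEndpoints F [] v = refl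
  sum-insideEndpoints F ((a , b) ∷ X) v rewrite filterᵇ-∷ (insideᵇ v) (a , b) X with insideᵇ v (a , b)
  ... | true = trans (sym (assoc (F a) (F b) _)) (cong ((F a ⊕ F b) ⊕_) (sum-insideEndpoints F X v))
  ... | false = trans (sum-insideEndpoints F X v) (sym (identityˡ _))

  sum-below-split : ∀ (F : Address → C) (A : List Address) (X : Matching) (v : Address) → Unique A → IsMatching A X →
    sum (λ p → [ v ≼ᵇ p ]· F p) A
      ≡ sum (λ p → [ matchedOutsideᵇ X v p ]· F p) A ⊕ sum (λ e → [ insideᵇ v e ]· (F (proj₁ e) ⊕ F (proj₂ e))) X
  sum-below-split F A X v uA mX = begin
      sum (λ p → [ v ≼ᵇ p ]· F p) A
    ≡⟨ sum-cong A (λ p → [∧¬]·⊕[∧]· (v ≼ᵇ p) (partnerInsideᵇ X v p) (F p)) ⟩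
      sum (λ p → [ matchedOutsideᵇ X v p ]· F p ⊕ [ (v ≼ᵇ p) ∧ partnerInsideᵇ X v p ]· F p) A
    ≡⟨ sum-⊕ _ _ A ⟩
      sum (λ p → [ matchedOutsideᵇ X v p ]· F p) A ⊕ sum (λ p → [ (v ≼ᵇ p) ∧ partnerInsideᵇ X v p ]· F p) A
    ≡⟨ cong (outside ⊕_) (sum-cong A (λ p → cong ([_]· F p) (partnerInside-member X v p))) ⟩
      sum (λ p → [ matchedOutsideᵇ X v p ]· F p) A ⊕ sum (λ p → [ memberᵇ p (insideEndpoints X v) ]· F p) A
    ≡⟨ cong (outside ⊕_) (sum-member F A (insideEndpoints X v) uA
                      (Unique-insideEndpoints X v (proj₂ mX)) (All-insideEndpoints X v (endpoints-∈ A X mX))) ⟩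
      sum (λ p → [ matchedOutsideᵇ X v p ]· F p) A ⊕ sum F (insideEndpoints X v)
    ≡⟨ cong (outside ⊕_) (sum-insideEndpoints F X v) ⟩
      sum (λ p → [ matchedOutsideᵇ X v p ]· F p) A ⊕ sum (λ e → [ insideᵇ v e ]· (F (proj₁ e) ⊕ F (proj₂ e))) X ∎
    where
      open ≡-Reasoning
      outside : C
      outside = sum (λ p → [ matchedOutsideᵇ X v p ]· F p) A

module ℕΣ = IndicatorSums ℕP.+-0-isCommutativeMonoid
open IndicatorSums ℚP.+-0-isCommutativeMonoid

x≤x+y : ∀ {x y : ℚ} → 0ℚ ≤ y → x ≤ x + y
x≤x+y {x} 0≤y = subst (_≤ x + _) (ℚP.+-identityʳ x) (ℚP.+-monoʳ-≤ x 0≤y)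

x≤y+x : ∀ {x y : ℚ} → 0ℚ ≤ y → x ≤ y + x
x≤y+x {x} {y} 0≤y = subst (x ≤_) (ℚP.+-comm x y) (x≤x+y 0≤y)

0≤y-x : ∀ {x y : ℚ} → x ≤ y → 0ℚ ≤ y - x
0≤y-x {x} {y} x≤y = subst (_≤ y - x) (ℚP.+-inverseʳ x) (ℚP.+-monoˡ-≤ (ℚ.- x) x≤y)

[]·-nonneg : ∀ b {x : ℚ} → 0ℚ ≤ x → 0ℚ ≤ [ b ]· x
[]·-nonneg true 0≤x = 0≤x
[]·-nonneg false _ = ℚP.≤-refl

+-cancelʳ-≤ : ∀ (x y z : ℚ) → x + z ≤ y + z → x ≤ y
+-cancelʳ-≤ x y z x+z≤y+z =
  subst₂ _≤_ (solve 2 (λ x z → (x :+ z) :- z := x) refl x z) (solve 2 (λ y z → (y :+ z) :- z := y) refl y z)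
    (ℚP.+-monoˡ-≤ (ℚ.- z) x+z≤y+z)
  where open +-*-Solver

indicator-xor-bound : ∀ (g γ : ℚ) σ π → γ ≤ g → [ σ ]· γ + [ π ]· (g - γ) ≤ [ σ xor π ]· (g - γ) + [ σ ]· g
indicator-xor-bound g γ false π _ = ℚP.≤-reflexive (ℚP.+-comm 0ℚ ([ π ]· (g - γ)))
indicator-xor-bound g γ true true _ = ℚP.≤-reflexive (solve 2 (λ g γ → γ :+ (g :- γ) := con 0ℚ :+ g) refl g γ)
  where open +-*-Solver
indicator-xor-bound g γ true false γ≤g =
  ℚP.≤-trans (ℚP.≤-reflexive (ℚP.+-identityʳ γ)) (ℚP.≤-trans γ≤g (x≤y+x (0≤y-x γ≤g)))

sum-nonneg : {X : Set} {f : X → ℚ} (xs : List X) → All (λ x → 0ℚ ≤ f x) xs → 0ℚ ≤ sum f xs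
sum-nonneg [] [] = ℚP.≤-refl
sum-nonneg (x ∷ xs) (0≤fx ∷ 0≤f) = ℚP.+-mono-≤ 0≤fx (sum-nonneg xs 0≤f)

sum-mono : {X : Set} {f g : X → ℚ} (xs : List X) → All (λ x → f x ≤ g x) xs → sum f xs ≤ sum g xs
sum-mono [] [] = ℚP.≤-refl
sum-mono (x ∷ xs) (fx≤gx ∷ f≤g) = ℚP.+-mono-≤ fx≤gx (sum-mono xs f≤g)

term≤sum : {X : Set} {f : X → ℚ} (xs : List X) → All (λ x → 0ℚ ≤ f x) xs → ∀ {x} → x ∈ xs → f x ≤ sum f xs
term≤sum (y ∷ xs) (_ ∷ 0≤f) (here refl) = x≤x+y (sum-nonneg xs 0≤f)
term≤sum (y ∷ xs) (0≤fy ∷ 0≤f) (there x∈xs) = ℚP.≤-trans (term≤sum xs 0≤f x∈xs) (x≤y+x 0≤fy)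

sumFrom-nonneg : {X : Set} {f : ℕ → X → ℚ} (k : ℕ) (xs : List X) → All (λ x → ∀ i → 0ℚ ≤ f i x) xs →
  0ℚ ≤ sumFrom f k xs
sumFrom-nonneg k [] [] = ℚP.≤-refl
sumFrom-nonneg k (x ∷ xs) (0≤fx ∷ 0≤f) = ℚP.+-mono-≤ (0≤fx k) (sumFrom-nonneg (suc k) xs 0≤f)

term≤sumFrom : {X : Set} {f : ℕ → X → ℚ} (k : ℕ) (xs : List X) → All (λ x → ∀ i → 0ℚ ≤ f i x) xs →
  ∀ d {x} → nth xs d ≡ just x → f (k ℕ.+ d) x ≤ sumFrom f k xs
term≤sumFrom k (x ∷ xs) (_ ∷ 0≤f) zero refl rewrite ℕP.+-identityʳ k = x≤x+y (sumFrom-nonneg (suc k) xs 0≤f)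
term≤sumFrom k (x ∷ xs) (0≤fx ∷ 0≤f) (suc d) hx rewrite ℕP.+-suc k d =
  ℚP.≤-trans (term≤sumFrom (suc k) xs 0≤f d hx) (x≤y+x (0≤fx k))

sumFrom-mono : {X : Set} {f g : ℕ → X → ℚ} (k : ℕ) (xs : List X) →
  (∀ d x → nth xs d ≡ just x → f (k ℕ.+ d) x ≤ g (k ℕ.+ d) x) → sumFrom f k xs ≤ sumFrom g k xs
sumFrom-mono k [] _ = ℚP.≤-refl
sumFrom-mono {f = f} {g} k (x ∷ xs) f≤g =
  ℚP.+-mono-≤ (subst (λ i → f i x ≤ g i x) (ℕP.+-identityʳ k) (f≤g 0 x refl))
              (sumFrom-mono (suc k) xs (λ d y hy → subst (λ i → f i y ≤ g i y) (ℕP.+-suc k d) (f≤g (suc d) y hy)))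

crossesAtᵇ : Address → Address × Address → Bool
crossesAtᵇ v (p , q) = insideᵇ v (p , q) ∧ (lca p q ==ᴬ v)

crossesAtᵇ-sound : ∀ v p q → crossesAtᵇ v (p , q) ≡ true → (v ≼ᵇ p) ≡ true × (v ≼ᵇ q) ≡ true × lca p q ≡ v
crossesAtᵇ-sound v p q crosses =
  ∧-conicalˡ _ _ inside , ∧-conicalʳ _ _ inside , does⇒ (lca p q ≟ᴬ v) (∧-conicalʳ (insideᵇ v (p , q)) _ crosses)
  where
    inside : insideᵇ v (p , q) ≡ true
    inside = ∧-conicalˡ _ _ crosses

[≼ᵇ]·-children : ∀ T v {g ts} p → subtreeAt T v ≡ just (node g ts) → IsPoint T p → ∀ (x : ℚ) →
  [ v ≼ᵇ p ]· x ≡ sumFrom (λ i _ → [ child v i ≼ᵇ p ]· x) 0 ts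
[≼ᵇ]·-children T v {ts = ts} p hv hp x with v ≼ᵇ p in v≼p
... | false = sym (sumFrom-ε 0 ts (λ i _ → cong ([_]· x) (child-⋠ᵇ v i p v≼p)))
... | true with point-below-node T v p hv hp v≼p
... | i , w , c , refl , hc =
  sym (trans (sumFrom-cong 0 ts (λ j _ → cong ([_]· x) (child-≼ᵇ v j i w))) (sumFrom-nth x ts i hc))

[insideᵇ]·-children : ∀ T v {g ts} p q → subtreeAt T v ≡ just (node g ts) → IsPoint T p → IsPoint T q → ∀ (x : ℚ) →
  [ insideᵇ v (p , q) ]· x ≡ sumFrom (λ i _ → [ insideᵇ (child v i) (p , q) ]· x) 0 ts + [ crossesAtᵇ v (p , q) ]· x
[insideᵇ]·-children T v {ts = ts} p q hv hp hq x with v ≼ᵇ p in v≼p | v ≼ᵇ q in v≼q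
... | false | _ =
  sym (trans (cong (_+ 0ℚ) (sumFrom-ε 0 ts (λ i _ → cong (λ b → [ b ∧ (child v i ≼ᵇ q) ]· x) (child-⋠ᵇ v i p v≼p))))
             (ℚP.+-identityˡ 0ℚ))
... | true | false =
  sym (trans (cong (_+ 0ℚ) (sumFrom-ε 0 ts (λ i _ → cong ([_]· x)
        (trans (cong ((child v i ≼ᵇ p) ∧_) (child-⋠ᵇ v i q v≼q)) (∧-zeroʳ _)))))
             (ℚP.+-identityˡ 0ℚ))
... | true | true with point-below-node T v p hv hp v≼p | point-below-node T v q hv hq v≼q
... | i , w , _ , refl , hc | j , w′ , _ , refl , _ with i ℕP.≟ j
... | yes refl rewrite lca-++ v (i ∷ w) (i ∷ w′) | ≡ᵇ-refl i | dec-false ((v ++ (i ∷ lca w w′)) ≟ᴬ v) (++-∷-≢ v i _) =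
  sym (trans (ℚP.+-identityʳ _)
             (trans (sumFrom-cong 0 ts (λ k _ → cong ([_]· x) (trans (cong₂ _∧_ (child-≼ᵇ v k i w) (child-≼ᵇ v k i w′))
                                                                       (∧-idem _))))
                    (sumFrom-nth x ts i hc)))
... | no i≢j rewrite lca-++ v (i ∷ w) (j ∷ w′) | lca-≢ w w′ i≢j | ++-identityʳ v | ==ᴬ-refl v =
  sym (trans (cong (_+ x) (sumFrom-ε 0 ts (λ k _ → cong ([_]· x)
                (trans (cong₂ _∧_ (child-≼ᵇ v k i w) (child-≼ᵇ v k j w′)) (notBoth k)))))
             (ℚP.+-identityˡ x))
  where
    notBoth : ∀ k → ((k ≡ᵇ i) ∧ (k ≡ᵇ j)) ≡ false
    notBoth k with k ≡ᵇ i in k≡ᵇi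
    ... | false = refl
    ... | true = ≡ᵇ-≢ (λ k≡j → i≢j (trans (sym (does⇒ (k ℕP.≟ i) k≡ᵇi)) k≡j))

EdgesArePoints : Tree → Matching → Set
EdgesArePoints T X = All (λ e → IsPoint T (proj₁ e) × IsPoint T (proj₂ e)) X

edgesArePoints : ∀ T A X → All (IsPoint T) A → IsMatching A X → EdgesArePoints T X
edgesArePoints T A [] _ _ = []
edgesArePoints T A (_ ∷ X) A-points ((_ , _ , refl , p∈A , q∈A , _) ∷ edges , _ ∷ _ ∷ u) =
  (All.lookup A-points p∈A , All.lookup A-points q∈A) ∷ edgesArePoints T A X A-points (edges , u)

module Cuts (T : Tree) (A : List Address) where

  innerCost : Matching → Address → ℚ
  innerCost X v = sum (λ e → [ insideᵇ v e ]· dist T (proj₁ e) (proj₂ e)) X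

  outsideSum : Matching → Address → (Address → ℚ) → ℚ
  outsideSum X v F = sum (λ p → [ matchedOutsideᵇ X v p ]· F p) A

  crossingSum : Matching → Address → (Address → ℚ) → ℚ
  crossingSum X v F = sum (λ e → [ crossesAtᵇ v e ]· (F (proj₁ e) + F (proj₂ e))) X

  Cost≡innerCost-root : ∀ X → Cost T X ≡ innerCost X []
  Cost≡innerCost-root [] = refl
  Cost≡innerCost-root ((p , q) ∷ X) = cong (dist T p q +_) (Cost≡innerCost-root X)

  innerCost-leaf : ∀ X → EdgesArePoints T X → ∀ w → subtreeAt T w ≡ just leaf → innerCost X w ≡ 0ℚ
  innerCost-leaf X X-points w hw = sum-ε X (All.map (λ {e} → atLeaf e) X-points)
    where
      atLeaf : ∀ e → IsPoint T (proj₁ e) × IsPoint T (proj₂ e) → [ insideᵇ w e ]· dist T (proj₁ e) (proj₂ e) ≡ 0ℚ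
      atLeaf (p , q) (hp , hq) with w ≼ᵇ p in w≼p | w ≼ᵇ q in w≼q
      ... | false | _ = refl
      ... | true | false = refl
      ... | true | true rewrite point-below-leaf T w p hw hp w≼p | point-below-leaf T w q hw hq w≼q | lca-refl w | hw = refl

  outsideSum-0 : ∀ X w → outsideSum X w (λ _ → 0ℚ) ≡ 0ℚ
  outsideSum-0 X w = sum-ε A (All.tabulate (λ {p} _ → []·-ε (matchedOutsideᵇ X w p)))

  outsideSum-cong : ∀ X w {F G : Address → ℚ} → (∀ p → (w ≼ᵇ p) ≡ true → F p ≡ G p) → outsideSum X w F ≡ outsideSum X w G
  outsideSum-cong X w {F} {G} F≗G = sum-cong A agree
    where
      agree : ∀ p → [ matchedOutsideᵇ X w p ]· F p ≡ [ matchedOutsideᵇ X w p ]· G p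
      agree p with matchedOutsideᵇ X w p in p-out
      ... | false = refl
      ... | true = F≗G p (∧-conicalˡ _ _ p-out)

  module AtNode (v : Address) {g : ℚ} {ts : List Tree} (hv : subtreeAt T v ≡ just (node g ts))
                (A-points : All (IsPoint T) A) where

    insideSum : Matching → Address → (Address → ℚ) → ℚ
    insideSum X w F = sum (λ e → [ insideᵇ w e ]· (F (proj₁ e) + F (proj₂ e))) X

    belowSum-children : ∀ (F : Address → ℚ) →
      sum (λ p → [ v ≼ᵇ p ]· F p) A ≡ sumFrom (λ i _ → sum (λ p → [ child v i ≼ᵇ p ]· F p) A) 0 ts
    belowSum-children F =
      trans (sum-cong-All A (All.map (λ {p} hp → [≼ᵇ]·-children T v p hv hp (F p)) A-points))
            (sum-sumFrom (λ i _ p → [ child v i ≼ᵇ p ]· F p) 0 ts A)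

    insideEdges-children : ∀ X (H : Address × Address → ℚ) → EdgesArePoints T X →
      sum (λ e → [ insideᵇ v e ]· H e) X
        ≡ sumFrom (λ i _ → sum (λ e → [ insideᵇ (child v i) e ]· H e) X) 0 ts + sum (λ e → [ crossesAtᵇ v e ]· H e) X
    insideEdges-children X H X-points = begin
        sum (λ e → [ insideᵇ v e ]· H e) X
      ≡⟨ sum-cong-All X (All.map (λ { {p , q} (hp , hq) → [insideᵇ]·-children T v p q hv hp hq (H (p , q)) }) X-points) ⟩
        sum (λ e → sumFrom (λ i _ → [ insideᵇ (child v i) e ]· H e) 0 ts + [ crossesAtᵇ v e ]· H e) X
      ≡⟨ sum-⊕ _ _ X ⟩
        sum (λ e → sumFrom (λ i _ → [ insideᵇ (child v i) e ]· H e) 0 ts) X + sum (λ e → [ crossesAtᵇ v e ]· H e) X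
      ≡⟨ cong (_+ sum (λ e → [ crossesAtᵇ v e ]· H e) X) (sum-sumFrom (λ i _ e → [ insideᵇ (child v i) e ]· H e) 0 ts X) ⟩
        sumFrom (λ i _ → sum (λ e → [ insideᵇ (child v i) e ]· H e) X) 0 ts + sum (λ e → [ crossesAtᵇ v e ]· H e) X ∎
      where open ≡-Reasoning

    innerCost-children : ∀ X → IsMatching A X →
      innerCost X v ≡ sumFrom (λ i _ → innerCost X (child v i)) 0 ts + sum (λ e → [ crossesAtᵇ v e ]· g) X
    innerCost-children X mX =
      trans (insideEdges-children X (λ (p , q) → dist T p q) (edgesArePoints T A X A-points mX))
            (cong (sumFrom (λ i _ → innerCost X (child v i)) 0 ts +_) (sum-cong X crossingCost))
      where
        crossingCost : ∀ e → [ crossesAtᵇ v e ]· dist T (proj₁ e) (proj₂ e) ≡ [ crossesAtᵇ v e ]· g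
        crossingCost (p , q) with crossesAtᵇ v (p , q) in crosses
        ... | false = refl
        ... | true rewrite proj₂ (proj₂ (crossesAtᵇ-sound v p q crosses)) | hv = refl

    outsideSum-children : ∀ X → Unique A → IsMatching A X → ∀ (F : Address → ℚ) →
      outsideSum X v F + crossingSum X v F ≡ sumFrom (λ i _ → outsideSum X (child v i) F) 0 ts
    outsideSum-children X uA mX F =
      ∙-cancelʳ S (outsideSum X v F + crossingSum X v F) (sumFrom (λ i _ → outsideSum X (child v i) F) 0 ts) (begin
        (outsideSum X v F + crossingSum X v F) + S
      ≡⟨ solve 3 (λ o c s → (o :+ c) :+ s := o :+ (s :+ c)) refl (outsideSum X v F) (crossingSum X v F) S ⟩
        outsideSum X v F + (S + crossingSum X v F)
      ≡⟨ cong (outsideSum X v F +_) (sym (insideEdges-children X (λ (p , q) → F p + F q) (edgesArePoints T A X A-points mX))) ⟩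
        outsideSum X v F + insideSum X v F
      ≡⟨ sym (split v) ⟩
        sum (λ p → [ v ≼ᵇ p ]· F p) A
      ≡⟨ belowSum-children F ⟩
        sumFrom (λ i _ → sum (λ p → [ child v i ≼ᵇ p ]· F p) A) 0 ts
      ≡⟨ sumFrom-cong 0 ts (λ i _ → split (child v i)) ⟩
        sumFrom (λ i _ → outsideSum X (child v i) F + insideSum X (child v i) F) 0 ts
      ≡⟨ sumFrom-⊕ _ _ 0 ts ⟩
        sumFrom (λ i _ → outsideSum X (child v i) F) 0 ts + S ∎)
      where
        open ≡-Reasoning
        open +-*-Solver
        S : ℚ
        S = sumFrom (λ i _ → insideSum X (child v i) F) 0 ts
        split : ∀ w → sum (λ p → [ w ≼ᵇ p ]· F p) A ≡ outsideSum X w F + insideSum X w F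
        split w = sum-below-split F A X w uA mX

-- Parities of counts

isOdd : ℕ → Bool
isOdd zero = false
isOdd (suc zero) = true
isOdd (suc (suc n)) = isOdd n

isOdd-suc : ∀ n → isOdd (suc n) ≡ not (isOdd n)
isOdd-suc zero = refl
isOdd-suc (suc zero) = refl
isOdd-suc (suc (suc n)) = isOdd-suc n

isOdd-+ : ∀ m n → isOdd (m ℕ.+ n) ≡ isOdd m xor isOdd n
isOdd-+ zero n = refl
isOdd-+ (suc zero) n = isOdd-suc n
isOdd-+ (suc (suc m)) n = isOdd-+ m n

isOdd⇒Odd : ∀ n → isOdd n ≡ true → Odd n
isOdd⇒Odd (suc zero) _ = refl
isOdd⇒Odd (suc (suc n)) h = isOdd⇒Odd n h

Odd⇒isOdd : ∀ n → Odd n → isOdd n ≡ true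
Odd⇒isOdd (suc zero) _ = refl
Odd⇒isOdd (suc (suc n)) h = Odd⇒isOdd n h

isOdd-sum-twos : {X : Set} (b : X → Bool) (xs : List X) → isOdd (ℕΣ.sum (λ x → ℕΣ.[ b x ]· 2) xs) ≡ false
isOdd-sum-twos b [] = refl
isOdd-sum-twos b (x ∷ xs) with b x
... | true = isOdd-sum-twos b xs
... | false = isOdd-sum-twos b xs

count≡sum : ∀ (f : Address → Bool) A → count f A ≡ ℕΣ.sum (λ a → ℕΣ.[ f a ]· 1) A
count≡sum f [] = refl
count≡sum f (a ∷ A) rewrite filterᵇ-∷ f a A with f a
... | true = cong suc (count≡sum f A)
... | false = count≡sum f A

count-cong : ∀ (f g : Address → Bool) A → (∀ a → f a ≡ g a) → count f A ≡ count g A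
count-cong f g A f≗g =
  trans (count≡sum f A) (trans (ℕΣ.sum-cong A (λ a → cong (ℕΣ.[_]· 1) (f≗g a))) (sym (count≡sum g A)))

count-split : ∀ (f g : Address → Bool) A → count f A ≡ count (λ a → f a ∧ not (g a)) A ℕ.+ count (λ a → f a ∧ g a) A
count-split f g A = begin
    count f A
  ≡⟨ count≡sum f A ⟩
    ℕΣ.sum (λ a → ℕΣ.[ f a ]· 1) A
  ≡⟨ ℕΣ.sum-cong A (λ a → ℕΣ.[∧¬]·⊕[∧]· (f a) (g a) 1) ⟩
    ℕΣ.sum (λ a → ℕΣ.[ f a ∧ not (g a) ]· 1 ℕ.+ ℕΣ.[ f a ∧ g a ]· 1) A
  ≡⟨ ℕΣ.sum-⊕ _ _ A ⟩
    ℕΣ.sum (λ a → ℕΣ.[ f a ∧ not (g a) ]· 1) A ℕ.+ ℕΣ.sum (λ a → ℕΣ.[ f a ∧ g a ]· 1) A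
  ≡⟨ sym (cong₂ ℕ._+_ (count≡sum _ A) (count≡sum _ A)) ⟩
    count (λ a → f a ∧ not (g a)) A ℕ.+ count (λ a → f a ∧ g a) A ∎
  where open ≡-Reasoning

count-odd⇒∃ : ∀ (f : Address → Bool) A → isOdd (count f A) ≡ true → ∃ λ a → a ∈ A × f a ≡ true
count-odd⇒∃ f (a ∷ A) h rewrite filterᵇ-∷ f a A with f a in fa
... | true = a , here refl , fa
... | false = let b , b∈A , fb = count-odd⇒∃ f A h in b , there b∈A , fb

All-endpoints : ∀ {P : Address → Set} X → All P (endpoints X) → All (λ e → P (proj₁ e) × P (proj₂ e)) X
All-endpoints [] [] = []
All-endpoints (_ ∷ X) (Pp ∷ Pq ∷ Ps) = (Pp , Pq) ∷ All-endpoints X Ps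

isOdd-matchedOutside : ∀ (keep : Address → Bool) A X v → Unique A → IsMatching A X →
  All (λ p → keep p ≡ true) (endpoints X) →
  isOdd (count (λ a → (v ≼ᵇ a) ∧ keep a) A) ≡ isOdd (count (λ a → matchedOutsideᵇ X v a ∧ keep a) A)
isOdd-matchedOutside keep A X v uA mX kept = begin
    isOdd (count (λ a → (v ≼ᵇ a) ∧ keep a) A)
  ≡⟨ cong isOdd (trans (count≡sum _ A) (ℕΣ.sum-cong A (λ a → ℕΣ.[∧]· (v ≼ᵇ a) (keep a) 1))) ⟩
    isOdd (ℕΣ.sum (λ a → ℕΣ.[ v ≼ᵇ a ]· one a) A)
  ≡⟨ cong isOdd (ℕΣ.sum-below-split one A X v uA mX) ⟩
    isOdd (outside ℕ.+ ℕΣ.sum (λ e → ℕΣ.[ insideᵇ v e ]· (one (proj₁ e) ℕ.+ one (proj₂ e))) X)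
  ≡⟨ isOdd-+ outside _ ⟩
    isOdd outside xor isOdd (ℕΣ.sum (λ e → ℕΣ.[ insideᵇ v e ]· (one (proj₁ e) ℕ.+ one (proj₂ e))) X)
  ≡⟨ cong (λ n → isOdd outside xor isOdd n) (ℕΣ.sum-cong-All X (All.map twos (All-endpoints X kept))) ⟩
    isOdd outside xor isOdd (ℕΣ.sum (λ e → ℕΣ.[ insideᵇ v e ]· 2) X)
  ≡⟨ cong (isOdd outside xor_) (isOdd-sum-twos (insideᵇ v) X) ⟩
    isOdd outside xor false
  ≡⟨ xor-identityʳ _ ⟩
    isOdd outside
  ≡⟨ cong isOdd (trans (ℕΣ.sum-cong A (λ a → sym (ℕΣ.[∧]· (matchedOutsideᵇ X v a) (keep a) 1))) (sym (count≡sum _ A))) ⟩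
    isOdd (count (λ a → matchedOutsideᵇ X v a ∧ keep a) A) ∎
  where
    open ≡-Reasoning
    one : Address → ℕ
    one a = ℕΣ.[ keep a ]· 1
    outside : ℕ
    outside = ℕΣ.sum (λ a → ℕΣ.[ matchedOutsideᵇ X v a ]· one a) A
    twos : ∀ {e} → keep (proj₁ e) ≡ true × keep (proj₂ e) ≡ true →
      ℕΣ.[ insideᵇ v e ]· (one (proj₁ e) ℕ.+ one (proj₂ e)) ≡ ℕΣ.[ insideᵇ v e ]· 2
    twos {e} (kp , kq) rewrite kp | kq = refl

notS : Maybe Address → Address → Bool
notS s p = maybe (λ s₀ → not (p ==ᴬ s₀)) true s

sBelow : Maybe Address → Address → Bool
sBelow s v = maybe (v ≼ᵇ_) false s

count-single : ∀ (f : Address → Bool) A s₀ → Unique A → s₀ ∈ A →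
  count (λ a → f a ∧ (a ==ᴬ s₀)) A ≡ ℕΣ.[ f s₀ ]· 1
count-single f A s₀ uA s₀∈A = begin
    count (λ a → f a ∧ (a ==ᴬ s₀)) A
  ≡⟨ count≡sum _ A ⟩
    ℕΣ.sum (λ a → ℕΣ.[ f a ∧ (a ==ᴬ s₀) ]· 1) A
  ≡⟨ ℕΣ.sum-cong A (λ a → trans (ℕΣ.[∧]· (f a) (a ==ᴬ s₀) 1)
                        (trans (ℕΣ.[]·-comm (f a) (a ==ᴬ s₀) 1) (cong (ℕΣ.[_]· _) (==ᴬ-sym a s₀)))) ⟩
    ℕΣ.sum (λ a → ℕΣ.[ s₀ ==ᴬ a ]· ℕΣ.[ f a ]· 1) A
  ≡⟨ ℕΣ.sum-pick (λ a → ℕΣ.[ f a ]· 1) s₀ A uA s₀∈A ⟩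
    ℕΣ.[ f s₀ ]· 1 ∎
  where open ≡-Reasoning

isOdd-without-s : ∀ A s → Unique A → (∀ s₀ → s ≡ just s₀ → s₀ ∈ A) → ∀ v →
  isOdd (count (λ a → (v ≼ᵇ a) ∧ notS s a) A) ≡ sBelow s v xor isOdd (count (v ≼ᵇ_) A)
isOdd-without-s A nothing _ _ v = cong isOdd (count-cong _ _ A (λ a → ∧-identityʳ (v ≼ᵇ a)))
isOdd-without-s A (just s₀) uA s∈A v
  rewrite count-split (v ≼ᵇ_) (_==ᴬ s₀) A | count-single (v ≼ᵇ_) A s₀ uA (s∈A s₀ refl)
  with v ≼ᵇ s₀
... | true rewrite ℕP.+-comm (count (λ a → (v ≼ᵇ a) ∧ not (a ==ᴬ s₀)) A) 1 =
  trans (sym (not-involutive _)) (cong not (sym (isOdd-suc (count (λ a → (v ≼ᵇ a) ∧ not (a ==ᴬ s₀)) A))))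
... | false rewrite ℕP.+-identityʳ (count (λ a → (v ≼ᵇ a) ∧ not (a ==ᴬ s₀)) A) = refl

-- Heavy children and heavy paths

heavyᵇ : ℕ → Tree → Bool
heavyᵇ W c = W <ᵇ (2 ℕ.* weight c)

<ᵇ⇒< : ∀ {m n} → (m <ᵇ n) ≡ true → m ℕ.< n
<ᵇ⇒< {m} {n} h = ℕP.<ᵇ⇒< m n (subst T (sym h) tt)

<ᵇ≡false⇒≮ : ∀ {m n} → (m <ᵇ n) ≡ false → ¬ (m ℕ.< n)
<ᵇ≡false⇒≮ h m<n = subst T h (ℕP.<⇒<ᵇ m<n)

weight≤weights : ∀ ts i {c} → nth ts i ≡ just c → weight c ℕ.≤ weights ts
weight≤weights (t ∷ ts) zero refl = ℕP.m≤m+n (weight t) (weights ts)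
weight≤weights (t ∷ ts) (suc i) hc = ℕP.≤-trans (weight≤weights ts i hc) (ℕP.m≤n+m (weights ts) (weight t))

two-weights≤weights : ∀ ts i j {ci cj} → i ≢ j → nth ts i ≡ just ci → nth ts j ≡ just cj →
  weight ci ℕ.+ weight cj ℕ.≤ weights ts
two-weights≤weights (t ∷ ts) zero zero i≢j _ _ = ⊥-elim (i≢j refl)
two-weights≤weights (t ∷ ts) zero (suc j) _ refl hj = ℕP.+-monoʳ-≤ (weight t) (weight≤weights ts j hj)
two-weights≤weights (t ∷ ts) (suc i) zero {ci} _ hi refl =
  subst (ℕ._≤ weights (t ∷ ts)) (ℕP.+-comm (weight t) (weight ci)) (ℕP.+-monoʳ-≤ (weight t) (weight≤weights ts i hi))
two-weights≤weights (t ∷ ts) (suc i) (suc j) i≢j hi hj =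
  ℕP.≤-trans (two-weights≤weights ts i j (λ i≡j → i≢j (cong suc i≡j)) hi hj) (ℕP.m≤n+m (weights ts) (weight t))

heavy-unique : ∀ ts i j {ci cj} → nth ts i ≡ just ci → nth ts j ≡ just cj →
  heavyᵇ (weights ts) ci ≡ true → heavyᵇ (weights ts) cj ≡ true → i ≡ j
heavy-unique ts i j {ci} {cj} hi hj heavy-i heavy-j with i ℕP.≟ j
... | yes i≡j = i≡j
... | no i≢j = ⊥-elim (ℕP.<-irrefl refl (ℕP.<-≤-trans 2W<2W (ℕP.*-monoʳ-≤ 2 (two-weights≤weights ts i j i≢j hi hj))))
  where
    2W<2W : 2 ℕ.* weights ts ℕ.< 2 ℕ.* (weight ci ℕ.+ weight cj)
    2W<2W = subst₂ ℕ._<_ (cong (weights ts ℕ.+_) (sym (ℕP.+-identityʳ (weights ts))))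
                          (sym (ℕP.*-distribˡ-+ 2 (weight ci) (weight cj)))
                          (ℕP.+-mono-< (<ᵇ⇒< {weights ts} {2 ℕ.* weight ci} heavy-i)
                                       (<ᵇ⇒< {weights ts} {2 ℕ.* weight cj} heavy-j))

mutual
  height : Tree → ℕ
  height leaf = 0
  height (node g ts) = suc (heights ts)

  heights : List Tree → ℕ
  heights [] = 0
  heights (t ∷ ts) = height t ⊔ heights ts

height≤heights : ∀ ts i {c} → nth ts i ≡ just c → height c ℕ.≤ heights ts
height≤heights (t ∷ ts) zero refl = ℕP.m≤m⊔n (height t) (heights ts)
height≤heights (t ∷ ts) (suc i) hc = ℕP.≤-trans (height≤heights ts i hc) (ℕP.m≤n⊔m (height t) (heights ts))

findHeavy-sound : ∀ W k cs {m} → findHeavy W k cs ≡ just m → ∃ λ d → ∃ λ c → m ≡ k ℕ.+ d × nth cs d ≡ just c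
findHeavy-sound W k (c ∷ cs) h with W <ᵇ (2 ℕ.* weight c)
findHeavy-sound W k (c ∷ cs) refl | true = 0 , c , sym (ℕP.+-identityʳ k) , refl
... | false = let d , c′ , m≡k+d , hc′ = findHeavy-sound W (suc k) cs h in
              suc d , c′ , trans m≡k+d (sym (ℕP.+-suc k d)) , hc′

findHeavy-complete : ∀ W k cs d {c} → nth cs d ≡ just c → heavyᵇ W c ≡ true →
  (∀ j {c′} → nth cs j ≡ just c′ → heavyᵇ W c′ ≡ true → j ≡ d) → findHeavy W k cs ≡ just (k ℕ.+ d)
findHeavy-complete W k (c₀ ∷ cs) zero refl heavy _ rewrite heavy | ℕP.+-identityʳ k = refl
findHeavy-complete W k (c₀ ∷ cs) (suc d) hc heavy unique with W <ᵇ (2 ℕ.* weight c₀) in heavy₀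
... | true = ⊥-elim (ℕP.0≢1+n (unique 0 refl heavy₀))
... | false = trans (findHeavy-complete W (suc k) cs d hc heavy (λ j hj heavy-j → ℕP.suc-injective (unique (suc j) hj heavy-j)))
                    (cong just (sym (ℕP.+-suc k d)))

heavyStep-heavy : ∀ T w {g ts} i {c} → subtreeAt T w ≡ just (node g ts) → nth ts i ≡ just c → heavyᵇ (weights ts) c ≡ true →
  heavyStep T w ≡ just (child w i)
heavyStep-heavy T w {g} {ts} i {c} hw hc heavy with subtreeAt T w
heavyStep-heavy T w {g} {ts} i {c} refl hc heavy | just .(node g ts)
  rewrite findHeavy-complete (weights ts) 0 ts i hc heavy (λ j hj heavy-j → heavy-unique ts j i hj hc heavy-j heavy) = refl

heavyStep-child : ∀ T w {w′} → heavyStep T w ≡ just w′ →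
  ∃ λ g → ∃ λ ts → ∃ λ i → ∃ λ c → subtreeAt T w ≡ just (node g ts) × nth ts i ≡ just c × w′ ≡ child w i
heavyStep-child T w h with subtreeAt T w
heavyStep-child T w h | just (node g ts) with findHeavy (weights ts) 0 ts in found
heavyStep-child T w refl | just (node g ts) | just m with findHeavy-sound (weights ts) 0 ts found
... | d , c , refl , hc = g , ts , d , c , refl , hc , refl

hp-prefix : ∀ T u j {w} → hp T u j ≡ just w → (u ≼ᵇ w) ≡ true
hp-prefix T u zero refl = ≼ᵇ-refl u
hp-prefix T u (suc j) h with hp T u j in uj
... | just w′ with heavyStep-child T w′ h
... | _ , _ , i , _ , _ , _ , refl = ≼ᵇ-trans u w′ (child w′ i) (hp-prefix T u j uj) (≼ᵇ-++ w′ (i ∷ []))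

hp-height : ∀ T u {tu} → subtreeAt T u ≡ just tu → ∀ j {w} → hp T u j ≡ just w →
  ∃ λ t → subtreeAt T w ≡ just t × height t ℕ.+ j ℕ.≤ height tu
hp-height T u {tu} hu zero refl = tu , hu , ℕP.≤-reflexive (ℕP.+-identityʳ _)
hp-height T u hu (suc j) h with hp T u j in uj
... | just w′ with heavyStep-child T w′ h | hp-height T u hu j uj
... | g , ts , i , c , hw′ , hc , refl | t , ht , t+j≤tu rewrite just-injective (trans (sym ht) hw′) =
  c , subtreeAt-child T w′ i hw′ hc ,
  ℕP.≤-trans (ℕP.≤-reflexive (ℕP.+-suc (height c) j)) (ℕP.≤-trans (ℕP.+-monoˡ-≤ j (s≤s (height≤heights ts i hc))) t+j≤tu)

hp-ends : ∀ T u {tu} → subtreeAt T u ≡ just tu → hp T u (suc (height tu)) ≡ nothing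
hp-ends T u {tu} hu with hp T u (suc (height tu)) in past-end
... | nothing = refl
... | just w with hp-height T u hu (suc (height tu)) past-end
... | t , _ , t+1+h≤h = ⊥-elim (ℕP.<-irrefl refl (ℕP.<-≤-trans (s≤s (ℕP.m≤n+m (height tu) (height t)))
                                                   (subst (ℕ._≤ height tu) (ℕP.+-suc (height t) (height tu)) t+1+h≤h)))

root-isHPTop : ∀ T → IsHPTop T []
root-isHPTop T = (T , refl) , λ where
  ([] , _ , () , _)
  ((_ ∷ _) , _ , () , _)

light-isHPTop : ∀ T w {g ts} i {c} → subtreeAt T w ≡ just (node g ts) → nth ts i ≡ just c → heavyᵇ (weights ts) c ≡ false →
  IsHPTop T (child w i)
light-isHPTop T w {g} {ts} i {c} hw hc light = (c , subtreeAt-child T w i hw hc) , notHeavy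
  where
    notHeavy : ¬ (∃ λ u → HeavyEdge T u (child w i))
    notHeavy (u , j , wi≡uj , tu , tv , hu , hv , heavy) with ∷ʳ-injective w u wi≡uj
    ... | refl , refl rewrite just-injective (trans (sym hu) hw) | just-injective (trans (sym hv) (subtreeAt-child T w i hw hc)) =
      <ᵇ≡false⇒≮ light heavy

least≥1 : (P : ℕ → Set) → (∀ n → Dec (P n)) → ∀ {K} → 1 ℕ.≤ K → P K →
  ∃ λ k → 1 ℕ.≤ k × P k × (∀ j → 1 ℕ.≤ j → j ℕ.< k → ¬ P j)
least≥1 P P? {K} 1≤K pK =
  search 1 (K ℕ.∸ 1) (ℕP.m+[n∸m]≡n 1≤K) ℕP.≤-refl (λ j 1≤j j<1 → ⊥-elim (ℕP.<⇒≱ j<1 1≤j))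
  where
    search : ∀ m n → m ℕ.+ n ≡ K → 1 ℕ.≤ m → (∀ j → 1 ℕ.≤ j → j ℕ.< m → ¬ P j) →
      ∃ λ k → 1 ℕ.≤ k × P k × (∀ j → 1 ℕ.≤ j → j ℕ.< k → ¬ P j)
    search m n m+n≡K 1≤m below with P? m
    ... | yes pm = m , 1≤m , pm , below
    search m zero m+0≡K _ _ | no ¬pm = ⊥-elim (¬pm (subst P (sym (trans (sym (ℕP.+-identityʳ m)) m+0≡K)) pK))
    search m (suc n) m+1+n≡K 1≤m below | no ¬pm =
      search (suc m) n (trans (sym (ℕP.+-suc m n)) m+1+n≡K) (ℕP.m≤n⇒m≤1+n 1≤m) below′
      where
        below′ : ∀ j → 1 ℕ.≤ j → j ℕ.< suc m → ¬ P j
        below′ j 1≤j j<1+m with j ℕP.≟ m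
        ... | yes refl = ¬pm
        ... | no j≢m = below j 1≤j (ℕP.≤∧≢⇒< (ℕP.≤-pred j<1+m) j≢m)

-- The label at which a point leaves the heavy path starting at a node

mutual
  exitLabel : Tree → Address → Address → ℚ
  exitLabel leaf v p = 0ℚ
  exitLabel (node g ts) v p = exitLabelFrom (weights ts) g v 0 ts p

  exitLabelFrom : ℕ → ℚ → Address → ℕ → List Tree → Address → ℚ
  exitLabelFrom W g v k [] p = g
  exitLabelFrom W g v k (c ∷ cs) p =
    if heavyᵇ W c ∧ (child v k ≼ᵇ p) then exitLabel c (child v k) p else exitLabelFrom W g v (suc k) cs p

exitLabelFrom-passed : ∀ W g v k cs i x → i ℕ.< k → exitLabelFrom W g v k cs (v ++ (i ∷ x)) ≡ g
exitLabelFrom-passed W g v k [] i x i<k = refl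
exitLabelFrom-passed W g v k (c ∷ cs) i x i<k
  rewrite child-≼ᵇ v k i x | ≡ᵇ-≢ (ℕP.>⇒≢ i<k) | ∧-zeroʳ (heavyᵇ W c)
  = exitLabelFrom-passed W g v (suc k) cs i x (ℕP.m<n⇒m<1+n i<k)

exitLabelFrom-at : ∀ W g v k cs d {c} i x → nth cs d ≡ just c → i ≡ k ℕ.+ d →
  exitLabelFrom W g v k cs (v ++ (i ∷ x)) ≡ (if heavyᵇ W c then exitLabel c (child v i) (v ++ (i ∷ x)) else g)
exitLabelFrom-at W g v k (c ∷ cs) zero i x refl i≡k+0
  rewrite i≡k+0 | ℕP.+-identityʳ k | child-≼ᵇ v k k x | ≡ᵇ-refl k | ∧-identityʳ (heavyᵇ W c) with heavyᵇ W c
... | true = refl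
... | false = exitLabelFrom-passed W g v (suc k) cs k x (ℕP.n<1+n k)
exitLabelFrom-at W g v k (c′ ∷ cs) (suc d) i x hc i≡k+1+d
  rewrite child-≼ᵇ v k i x
        | ≡ᵇ-≢ (λ k≡i → ℕP.m≢1+m+n k (trans k≡i (trans i≡k+1+d (ℕP.+-suc k d))))
        | ∧-zeroʳ (heavyᵇ W c′)
  = exitLabelFrom-at W g v (suc k) cs d i x hc (trans i≡k+1+d (ℕP.+-suc k d))

exitLabel-child : ∀ g ts i {c} x → nth ts i ≡ just c → ∀ v →
  exitLabel (node g ts) v (v ++ (i ∷ x)) ≡ (if heavyᵇ (weights ts) c then exitLabel c (child v i) (v ++ (i ∷ x)) else g)
exitLabel-child g ts i x hc v = exitLabelFrom-at (weights ts) g v 0 ts i i x hc refl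

exitLabel-below-child : ∀ g ts i {c} → nth ts i ≡ just c → ∀ v p → (child v i ≼ᵇ p) ≡ true →
  exitLabel (node g ts) v p ≡ (if heavyᵇ (weights ts) c then exitLabel c (child v i) p else g)
exitLabel-below-child g ts i hc v p vi≼p with ≼ᵇ⇒++ (child v i) p vi≼p
... | x , refl rewrite ++-assoc v (i ∷ []) x = exitLabel-child g ts i x hc v

mutual
  exitLabel-nonneg : ∀ t → ValidHST t → ∀ v p → 0ℚ ≤ exitLabel t v p
  exitLabel-nonneg leaf _ v p = ℚP.≤-refl
  exitLabel-nonneg (node g ts) (nodeV 0≤g _ _ valid) v p = exitLabelFrom-nonneg (weights ts) g v 0 ts 0≤g valid p

  exitLabelFrom-nonneg : ∀ W g v k cs → 0ℚ ≤ g → All ValidHST cs → ∀ p → 0ℚ ≤ exitLabelFrom W g v k cs p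
  exitLabelFrom-nonneg W g v k [] 0≤g [] p = 0≤g
  exitLabelFrom-nonneg W g v k (c ∷ cs) 0≤g (valid-c ∷ valid) p with heavyᵇ W c ∧ (child v k ≼ᵇ p)
  ... | true = exitLabel-nonneg c valid-c (child v k) p
  ... | false = exitLabelFrom-nonneg W g v (suc k) cs 0≤g valid p

-- an edge crossing at v has an endpoint in a light child, where the exit label is g itself
crossing≤exitLabels : ∀ T v {g ts} p q → subtreeAt T v ≡ just (node g ts) → ValidHST (node g ts) →
  IsPoint T p → IsPoint T q → crossesAtᵇ v (p , q) ≡ true →
  g ≤ exitLabel (node g ts) v p + exitLabel (node g ts) v q
crossing≤exitLabels T v {g} {ts} p q hv valid hp hq crosses with crossesAtᵇ-sound v p q crosses
... | v≼p , v≼q , lca≡v with point-below-node T v p hv hp v≼p | point-below-node T v q hv hq v≼q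
... | i , x , ci , refl , hi | j , y , cj , refl , hj with i ℕP.≟ j
... | yes refl = ⊥-elim (++-∷-≢ v i (lca x y) (trans (sym lca-pq) lca≡v))
  where
    lca-pq : lca (v ++ (i ∷ x)) (v ++ (i ∷ y)) ≡ v ++ (i ∷ lca x y)
    lca-pq rewrite lca-++ v (i ∷ x) (i ∷ y) | ≡ᵇ-refl i = refl
... | no i≢j with heavyᵇ (weights ts) ci in heavy-i | heavyᵇ (weights ts) cj in heavy-j
... | true | true = ⊥-elim (i≢j (heavy-unique ts i j hi hj heavy-i heavy-j))
... | false | _ rewrite exitLabel-child g ts i x hi v | heavy-i = x≤x+y (exitLabel-nonneg (node g ts) valid v (v ++ (j ∷ y)))
... | true | false rewrite exitLabel-child g ts j y hj v | heavy-j = x≤y+x (exitLabel-nonneg (node g ts) valid v (v ++ (i ∷ x)))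

sBelow-children : ∀ T v {g ts} s → subtreeAt T v ≡ just (node g ts) → (∀ s₀ → s ≡ just s₀ → IsPoint T s₀) →
  ∀ (x : ℚ) →
  [ sBelow s v ]· x ≡ sumFrom (λ i _ → [ sBelow s (child v i) ]· x) 0 ts
sBelow-children T v {ts = ts} nothing _ _ x = sym (sumFrom-ε 0 ts (λ _ _ → refl))
sBelow-children T v (just s₀) hv s-point x = [≼ᵇ]·-children T v s₀ hv (s-point s₀ refl) x

-- oddGaps t v is Φ restricted to the proper descendants of v. heavyOddGaps t v sums δ(u) over the nodes u
-- of the heavy path below v with |X_u ∩ A| odd.

module Potentials (A : List Address) (s : Maybe Address) where

  oddBelow : Address → Bool
  oddBelow v = isOdd (count (v ≼ᵇ_) A)

  oddBelowˢ : Address → Bool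
  oddBelowˢ v = isOdd (count (λ a → (v ≼ᵇ a) ∧ notS s a) A)

  mutual
    oddGaps : Tree → Address → ℚ
    oddGaps leaf v = 0ℚ
    oddGaps (node g ts) v = oddGapsFrom g v 0 ts

    oddGapsFrom : ℚ → Address → ℕ → List Tree → ℚ
    oddGapsFrom g v k [] = 0ℚ
    oddGapsFrom g v k (c ∷ cs) = ([ oddBelowˢ (child v k) ]· (g - label c) + oddGaps c (child v k)) + oddGapsFrom g v (suc k) cs

  mutual
    heavyOddGaps : Tree → Address → ℚ
    heavyOddGaps leaf v = 0ℚ
    heavyOddGaps (node g ts) v = heavyOddGapsFrom (weights ts) g v 0 ts

    heavyOddGapsFrom : ℕ → ℚ → Address → ℕ → List Tree → ℚ
    heavyOddGapsFrom W g v k [] = 0ℚ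
    heavyOddGapsFrom W g v k (c ∷ cs) =
      [ heavyᵇ W c ]· ([ oddBelow (child v k) ]· (g - label c) + heavyOddGaps c (child v k)) + heavyOddGapsFrom W g v (suc k) cs

  oddGapsFrom≡sumFrom : ∀ g v k cs →
    oddGapsFrom g v k cs ≡ sumFrom (λ i c → [ oddBelowˢ (child v i) ]· (g - label c) + oddGaps c (child v i)) k cs
  oddGapsFrom≡sumFrom g v k [] = refl
  oddGapsFrom≡sumFrom g v k (c ∷ cs) =
    cong (([ oddBelowˢ (child v k) ]· (g - label c) + oddGaps c (child v k)) +_) (oddGapsFrom≡sumFrom g v (suc k) cs)

  heavyOddGapsFrom≡sumFrom : ∀ W g v k cs →
    heavyOddGapsFrom W g v k cs
      ≡ sumFrom (λ i c → [ heavyᵇ W c ]· ([ oddBelow (child v i) ]· (g - label c) + heavyOddGaps c (child v i))) k cs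
  heavyOddGapsFrom≡sumFrom W g v k [] = refl
  heavyOddGapsFrom≡sumFrom W g v k (c ∷ cs) =
    cong ([ heavyᵇ W c ]· ([ oddBelow (child v k) ]· (g - label c) + heavyOddGaps c (child v k)) +_)
         (heavyOddGapsFrom≡sumFrom W g v (suc k) cs)

  mutual
    heavyOddGaps-nonneg : ∀ t → ValidHST t → ∀ v → 0ℚ ≤ heavyOddGaps t v
    heavyOddGaps-nonneg leaf _ v = ℚP.≤-refl
    heavyOddGaps-nonneg (node g ts) (nodeV _ _ below valid) v = heavyOddGapsFrom-nonneg (weights ts) g v 0 ts below valid

    heavyOddGapsFrom-nonneg : ∀ W g v k cs → All (λ c → label c ≤ g) cs → All ValidHST cs →
      0ℚ ≤ heavyOddGapsFrom W g v k cs
    heavyOddGapsFrom-nonneg W g v k [] [] [] = ℚP.≤-refl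
    heavyOddGapsFrom-nonneg W g v k (c ∷ cs) (c≤g ∷ below) (valid-c ∷ valid) =
      ℚP.+-mono-≤ (heavyTerm-nonneg W g v k c c≤g valid-c) (heavyOddGapsFrom-nonneg W g v (suc k) cs below valid)

    heavyTerm-nonneg : ∀ W g v i c → label c ≤ g → ValidHST c →
      0ℚ ≤ [ heavyᵇ W c ]· ([ oddBelow (child v i) ]· (g - label c) + heavyOddGaps c (child v i))
    heavyTerm-nonneg W g v i c c≤g valid-c =
      []·-nonneg (heavyᵇ W c) (ℚP.+-mono-≤ ([]·-nonneg (oddBelow (child v i)) (0≤y-x c≤g))
                                           (heavyOddGaps-nonneg c valid-c (child v i)))

count-nested : ∀ A w w′ → (w ≼ᵇ w′) ≡ true →
  count (w ≼ᵇ_) A ≡ count (λ a → (w ≼ᵇ a) ∧ not (w′ ≼ᵇ a)) A ℕ.+ count (w′ ≼ᵇ_) A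
count-nested A w w′ w≼w′ =
  trans (count-split (w ≼ᵇ_) (w′ ≼ᵇ_) A) (cong (count (λ a → (w ≼ᵇ a) ∧ not (w′ ≼ᵇ a)) A ℕ.+_) (count-cong _ _ A inner))
  where
    inner : ∀ a → ((w ≼ᵇ a) ∧ (w′ ≼ᵇ a)) ≡ (w′ ≼ᵇ a)
    inner a with w′ ≼ᵇ a in w′≼a
    ... | false = ∧-zeroʳ (w ≼ᵇ a)
    ... | true rewrite ≼ᵇ-trans w w′ a w≼w′ w′≼a = refl

-- Upper bound for an HP-inward matching

module UpperBound (T : Tree) (A : List Address) (s : Maybe Address) (M : Matching)
                  (A-points : All (IsPoint T) A) (uA : Unique A) (s∈A : ∀ s₀ → s ≡ just s₀ → s₀ ∈ A)
                  (hpi : HPInward T A M) where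

  open Cuts T A
  open Potentials A s

  outsideSum-top : ∀ w →
    (∀ p q → MatchedOutside A M w p → MatchedOutside A M w q → p ≡ q) →
    ((∃ λ p → MatchedOutside A M w p) → Odd (count (w ≼ᵇ_) A)) →
    (Odd (count (w ≼ᵇ_) A) → ∃ λ p → MatchedOutside A M w p) →
    (oddBelow w ≡ true × ∃ λ e → MatchedOutside A M w e × (∀ F → outsideSum M w F ≡ F e))
      ⊎ (oddBelow w ≡ false × (∀ F → outsideSum M w F ≡ 0ℚ))
  outsideSum-top w atMostOne out⇒odd odd⇒out with oddBelow w in odd
  ... | true = let e , e-out = odd⇒out (isOdd⇒Odd (count (w ≼ᵇ_) A) odd) in
    inj₁ (refl , e , e-out , λ F → trans (sum-cong-All A (All.tabulate (only-e F e e-out))) (sum-pick F e A uA (proj₁ e-out)))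
    where
      only-e : ∀ F e → MatchedOutside A M w e → ∀ {p} → p ∈ A → [ matchedOutsideᵇ M w p ]· F p ≡ [ e ==ᴬ p ]· F p
      only-e F e e-out {p} p∈A with matchedOutsideᵇ M w p in p-out | e ≟ᴬ p
      ... | false | no _ = refl
      ... | true | yes _ = refl
      ... | true | no e≢p = ⊥-elim (e≢p (atMostOne e p e-out (ᵇ⇒matchedOutside A M w p p∈A p-out)))
      ... | false | yes refl = case trans (sym p-out) (matchedOutside⇒ᵇ A M w e e-out) of λ ()
  ... | false = inj₂ (refl , λ F → sum-ε A (All.tabulate (none F)))
    where
      none : ∀ F {p} → p ∈ A → [ matchedOutsideᵇ M w p ]· F p ≡ 0ℚ
      none F {p} p∈A with matchedOutsideᵇ M w p in p-out
      ... | false = refl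
      ... | true = case trans (sym odd) (Odd⇒isOdd (count (w ≼ᵇ_) A) (out⇒odd (p , ᵇ⇒matchedOutside A M w p p∈A p-out))) of λ ()

  -- The recursion is on a bound n > height t, since children are reached through nth.
  exitLabel-bound : ∀ u k e → (∀ j {w′} → 1 ℕ.≤ j → j ℕ.< k → hp T u j ≡ just w′ → oddBelow w′ ≡ true) →
    inX (hp T u k) e ≡ false → IsPoint T e →
    ∀ n t → height t ℕ.< n → ∀ w j → subtreeAt T w ≡ just t → ValidHST t → hp T u j ≡ just w →
    (w ≼ᵇ e) ≡ true → j ℕ.< k →
    label t ≤ exitLabel t w e + heavyOddGaps t w
  exitLabel-bound u k e odd-on-path e-left he n leaf _ w j _ _ _ _ _ = ℚP.≤-reflexive (sym (ℚP.+-identityʳ 0ℚ))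
  exitLabel-bound u k e odd-on-path e-left he (suc n) (node g ts) (s≤s ht<n) w j hw valid@(nodeV _ _ below valid-ts) uj≡w w≼e j<k
    with point-below-node T w e hw he w≼e
  ... | i , x , c , refl , hc rewrite exitLabel-child g ts i x hc w with heavyᵇ (weights ts) c in heavy
  ... | false = x≤x+y (heavyOddGaps-nonneg (node g ts) valid w)
  ... | true = begin
      g                                                         ≡⟨ solve 2 (λ g l → g := (g :- l) :+ l) refl g (label c) ⟩
      (g - label c) + label c                                   ≤⟨ ℚP.+-monoʳ-≤ (g - label c) IH ⟩
      (g - label c) + (exitLabel c wi e′ + heavyOddGaps c wi)   ≡⟨ solve 3 (λ a h r → a :+ (h :+ r) := h :+ (a :+ r)) refl
                                                                      (g - label c) (exitLabel c wi e′) (heavyOddGaps c wi) ⟩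
      exitLabel c wi e′ + ((g - label c) + heavyOddGaps c wi)   ≤⟨ ℚP.+-monoʳ-≤ (exitLabel c wi e′) heavyGap≤ ⟩
      exitLabel c wi e′ + heavyOddGaps (node g ts) w            ∎
    where
      open ℚP.≤-Reasoning
      open +-*-Solver
      wi : Address
      wi = child w i
      e′ : Address
      e′ = w ++ (i ∷ x)
      u[1+j]≡wi : hp T u (suc j) ≡ just wi
      u[1+j]≡wi rewrite uj≡w = heavyStep-heavy T w i hw hc heavy
      1+j<k : suc j ℕ.< k
      1+j<k with suc j ℕP.≟ k
      ... | no 1+j≢k = ℕP.≤∧≢⇒< j<k 1+j≢k
      ... | yes refl = case trans (sym e-left) (trans (cong (λ v → inX v e′) u[1+j]≡wi) (trans (child-≼ᵇ w i i x) (≡ᵇ-refl i)))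
                       of λ ()
      IH : label c ≤ exitLabel c wi e′ + heavyOddGaps c wi
      IH = exitLabel-bound u k e′ odd-on-path e-left he n c (ℕP.<-≤-trans (s≤s (height≤heights ts i hc)) ht<n) wi (suc j)
             (subtreeAt-child T w i hw hc) (All.lookup valid-ts (nth⇒∈ ts i hc)) u[1+j]≡wi
             (subst (λ p → (wi ≼ᵇ p) ≡ true) (++-assoc w (i ∷ []) x) (≼ᵇ-++ wi x)) 1+j<k
      heavyGap≤ : (g - label c) + heavyOddGaps c wi ≤ heavyOddGaps (node g ts) w
      heavyGap≤ = subst₂ _≤_ term≡ (sym (heavyOddGapsFrom≡sumFrom (weights ts) g w 0 ts))
        (term≤sumFrom 0 ts (All.zipWith (λ (c≤g , valid-c) i′ → heavyTerm-nonneg (weights ts) g w i′ _ c≤g valid-c)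
                                        (below , valid-ts))
                      i hc)
        where
          term≡ : [ heavyᵇ (weights ts) c ]· ([ oddBelow wi ]· (g - label c) + heavyOddGaps c wi) ≡ (g - label c) + heavyOddGaps c wi
          term≡ rewrite heavy | odd-on-path (suc j) (s≤s z≤n) 1+j<k u[1+j]≡wi = refl

  exitLabel-top-bound : ∀ t w e → subtreeAt T w ≡ just t → ValidHST t → IsHPTop T w → oddBelow w ≡ true →
    MatchedOutside A M w e → label t ≤ exitLabel t w e + heavyOddGaps t w
  exitLabel-top-bound t w e hw valid top odd e-out =
    exitLabel-bound w i* e odd-on-path e-left (All.lookup A-points (proj₁ e-out)) (suc (height t)) t ℕP.≤-refl w 0 hw valid refl
      (proj₁ (proj₂ e-out)) 1≤i*
    where
      OddDiff : ℕ → Set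
      OddDiff j = Odd (diffCount T A w j)
      oddDiff-end : OddDiff (suc (height t))
      oddDiff-end rewrite hp-ends T w hw =
        subst Odd (count-cong _ _ A (λ a → sym (∧-identityʳ (w ≼ᵇ a)))) (isOdd⇒Odd (count (w ≼ᵇ_) A) odd)
      least : ∃ (IsIStar T A w)
      least = least≥1 OddDiff (λ j → diffCount T A w j % 2 ℕP.≟ 1) {suc (height t)} (s≤s z≤n) oddDiff-end
      i* : ℕ
      i* = proj₁ least
      1≤i* : 1 ℕ.≤ i*
      1≤i* = proj₁ (proj₂ least)
      e-left : inX (hp T w i*) e ≡ false
      e-left = proj₂ (proj₂ (proj₂ (proj₂ hpi w top))) e e-out i* (proj₂ least)
      odd-on-path : ∀ j {w′} → 1 ℕ.≤ j → j ℕ.< i* → hp T w j ≡ just w′ → oddBelow w′ ≡ true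
      odd-on-path j {w′} 1≤j j<i* wj≡w′ = begin
          oddBelow w′                           ≡⟨ cong (_xor oddBelow w′) (sym even-diff) ⟩
          isOdd diff xor oddBelow w′            ≡⟨ sym (isOdd-+ diff (count (w′ ≼ᵇ_) A)) ⟩
          isOdd (diff ℕ.+ count (w′ ≼ᵇ_) A)     ≡⟨ cong isOdd (sym (count-nested A w w′ (hp-prefix T w j wj≡w′))) ⟩
          oddBelow w                            ≡⟨ odd ⟩
          true                                  ∎
        where
          open ≡-Reasoning
          diff : ℕ
          diff = count (λ a → (w ≼ᵇ a) ∧ not (w′ ≼ᵇ a)) A
          even-diff : isOdd diff ≡ false
          even-diff with isOdd diff in odd-diff
          ... | false = refl
          ... | true = ⊥-elim (proj₂ (proj₂ (proj₂ least)) j 1≤j j<i*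
                         (subst (λ v → Odd (count (λ a → (w ≼ᵇ a) ∧ not (inX v a)) A)) (sym wj≡w′) (isOdd⇒Odd diff odd-diff)))

  CostBound : Tree → Address → Set
  CostBound t w = innerCost M w + outsideSum M w (exitLabel t w) + heavyOddGaps t w ≤ oddGaps t w + [ sBelow s w ]· label t

  innerCost-top : ∀ t w → subtreeAt T w ≡ just t → ValidHST t → IsHPTop T w → CostBound t w →
    innerCost M w + [ oddBelow w ]· label t ≤ oddGaps t w + [ sBelow s w ]· label t
  innerCost-top t w hw valid top bound with proj₂ hpi w top
  ... | atMostOne , out⇒odd , odd⇒out , _ with outsideSum-top w atMostOne out⇒odd odd⇒out
  ... | inj₂ (even , none) rewrite even =
    ℚP.≤-trans (ℚP.≤-reflexive (cong (innerCost M w +_) (sym (none (exitLabel t w)))))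
               (ℚP.≤-trans (x≤x+y (heavyOddGaps-nonneg t valid w)) bound)
  ... | inj₁ (odd , e , e-out , only-e) rewrite odd =
    ℚP.≤-trans (ℚP.+-monoʳ-≤ (innerCost M w) (exitLabel-top-bound t w e hw valid top odd e-out))
               (ℚP.≤-trans (ℚP.≤-reflexive regroup) bound)
    where
      regroup : innerCost M w + (exitLabel t w e + heavyOddGaps t w)
                ≡ innerCost M w + outsideSum M w (exitLabel t w) + heavyOddGaps t w
      regroup rewrite only-e (exitLabel t w) = sym (ℚP.+-assoc (innerCost M w) (exitLabel t w e) (heavyOddGaps t w))

  parity-step : ∀ wi (g lc Z Gc : ℚ) → lc ≤ g → Z ≤ Gc + [ sBelow s wi ]· lc →
    Z + [ oddBelow wi ]· (g - lc) ≤ ([ oddBelowˢ wi ]· (g - lc) + Gc) + [ sBelow s wi ]· g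
  parity-step wi g lc Z Gc lc≤g Z≤ = begin
      Z + [ oddBelow wi ]· (g - lc)                             ≤⟨ ℚP.+-monoˡ-≤ ([ oddBelow wi ]· (g - lc)) Z≤ ⟩
      (Gc + [ sBelow s wi ]· lc) + [ oddBelow wi ]· (g - lc)    ≡⟨ ℚP.+-assoc Gc _ _ ⟩
      Gc + ([ sBelow s wi ]· lc + [ oddBelow wi ]· (g - lc))    ≤⟨ ℚP.+-monoʳ-≤ Gc
                                                                     (indicator-xor-bound g lc (sBelow s wi) (oddBelow wi) lc≤g) ⟩
      Gc + ([ sBelow s wi xor oddBelow wi ]· (g - lc) + [ sBelow s wi ]· g)
                                                                ≡⟨ cong (λ b → Gc + ([ b ]· (g - lc) + [ sBelow s wi ]· g))
                                                                        (sym (isOdd-without-s A s uA s∈A wi)) ⟩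
      Gc + ([ oddBelowˢ wi ]· (g - lc) + [ sBelow s wi ]· g)    ≡⟨ solve 3 (λ a b c → a :+ (b :+ c) := (b :+ a) :+ c) refl
                                                                         Gc ([ oddBelowˢ wi ]· (g - lc)) ([ sBelow s wi ]· g) ⟩
      ([ oddBelowˢ wi ]· (g - lc) + Gc) + [ sBelow s wi ]· g    ∎
    where
      open ℚP.≤-Reasoning
      open +-*-Solver

  heavyChild-bound : ∀ w {g ts} → subtreeAt T w ≡ just (node g ts) → ∀ d {c} → nth ts d ≡ just c → label c ≤ g →
    heavyᵇ (weights ts) c ≡ true → CostBound c (child w d) →
    (innerCost M (child w d) + outsideSum M (child w d) (exitLabel (node g ts) w))
      + ([ oddBelow (child w d) ]· (g - label c) + heavyOddGaps c (child w d))
    ≤ ([ oddBelowˢ (child w d) ]· (g - label c) + oddGaps c (child w d)) + [ sBelow s (child w d) ]· g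
  heavyChild-bound w {g} {ts} hw d {c} hc c≤g heavy IH = begin
      (innerCost M wi + outsideSum M wi H) + ([ oddBelow wi ]· (g - label c) + heavyOddGaps c wi)
        ≡⟨ cong (λ o → (innerCost M wi + o) + ([ oddBelow wi ]· (g - label c) + heavyOddGaps c wi)) H≗exit ⟩
      (innerCost M wi + outsideSum M wi (exitLabel c wi)) + ([ oddBelow wi ]· (g - label c) + heavyOddGaps c wi)
        ≡⟨ solve 3 (λ a p r → a :+ (p :+ r) := (a :+ r) :+ p) refl
             (innerCost M wi + outsideSum M wi (exitLabel c wi)) ([ oddBelow wi ]· (g - label c)) (heavyOddGaps c wi) ⟩
      ((innerCost M wi + outsideSum M wi (exitLabel c wi)) + heavyOddGaps c wi) + [ oddBelow wi ]· (g - label c)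
        ≤⟨ parity-step wi g (label c) _ (oddGaps c wi) c≤g IH ⟩
      ([ oddBelowˢ wi ]· (g - label c) + oddGaps c wi) + [ sBelow s wi ]· g ∎
    where
      open ℚP.≤-Reasoning
      open +-*-Solver
      wi : Address
      wi = child w d
      H : Address → ℚ
      H = exitLabel (node g ts) w
      H≗exit : outsideSum M wi H ≡ outsideSum M wi (exitLabel c wi)
      H≗exit = outsideSum-cong M wi (λ p wi≼p → trans (exitLabel-below-child g ts d hc w p wi≼p)
                                                      (cong (λ b → if b then exitLabel c wi p else g) heavy))

  lightChild-bound : ∀ w {g ts} → subtreeAt T w ≡ just (node g ts) → ∀ d {c} → nth ts d ≡ just c → label c ≤ g → ValidHST c →
    heavyᵇ (weights ts) c ≡ false → CostBound c (child w d) →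
    innerCost M (child w d) + outsideSum M (child w d) (exitLabel (node g ts) w)
    ≤ ([ oddBelowˢ (child w d) ]· (g - label c) + oddGaps c (child w d)) + [ sBelow s (child w d) ]· g
  lightChild-bound w {g} {ts} hw d {c} hc c≤g valid-c light IH = begin
      innerCost M wi + outsideSum M wi H                  ≡⟨ cong (innerCost M wi +_) H≗g ⟩
      innerCost M wi + [ oddBelow wi ]· g                 ≡⟨ cong (λ x → innerCost M wi + [ oddBelow wi ]· x)
                                                               (solve 2 (λ g l → g := l :+ (g :- l)) refl g (label c)) ⟩
      innerCost M wi + [ oddBelow wi ]· (label c + (g - label c))
                                                          ≡⟨ cong (innerCost M wi +_) ([]·-⊕ (oddBelow wi) (label c) (g - label c)) ⟩
      innerCost M wi + ([ oddBelow wi ]· label c + [ oddBelow wi ]· (g - label c))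
                                                          ≡⟨ sym (ℚP.+-assoc (innerCost M wi) _ _) ⟩
      (innerCost M wi + [ oddBelow wi ]· label c) + [ oddBelow wi ]· (g - label c)
                                                          ≤⟨ parity-step wi g (label c) _ (oddGaps c wi) c≤g
                                                               (innerCost-top c wi (subtreeAt-child T w d hw hc) valid-c top IH) ⟩
      ([ oddBelowˢ wi ]· (g - label c) + oddGaps c wi) + [ sBelow s wi ]· g ∎
    where
      open ℚP.≤-Reasoning
      open +-*-Solver
      wi : Address
      wi = child w d
      H : Address → ℚ
      H = exitLabel (node g ts) w
      top : IsHPTop T wi
      top = light-isHPTop T w d hw hc light
      H≗g : outsideSum M wi H ≡ [ oddBelow wi ]· g
      H≗g with proj₂ hpi wi top
      ... | atMostOne , out⇒odd , odd⇒out , _ with outsideSum-top wi atMostOne out⇒odd odd⇒out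
      ... | inj₁ (odd , e , e-out , only-e) rewrite odd =
        trans (only-e H) (trans (exitLabel-below-child g ts d hc w e (proj₁ (proj₂ e-out)))
                                (cong (λ b → if b then exitLabel c wi e else g) light))
      ... | inj₂ (even , none) rewrite even = none H

  child-bound : ∀ w {g ts} → subtreeAt T w ≡ just (node g ts) → ∀ d {c} → nth ts d ≡ just c → label c ≤ g → ValidHST c →
    CostBound c (child w d) →
    (innerCost M (child w d) + outsideSum M (child w d) (exitLabel (node g ts) w))
      + [ heavyᵇ (weights ts) c ]· ([ oddBelow (child w d) ]· (g - label c) + heavyOddGaps c (child w d))
    ≤ ([ oddBelowˢ (child w d) ]· (g - label c) + oddGaps c (child w d)) + [ sBelow s (child w d) ]· g
  child-bound w {g} {ts} hw d {c} hc c≤g valid-c IH with heavyᵇ (weights ts) c in heavy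
  ... | true = heavyChild-bound w hw d hc c≤g heavy IH
  ... | false = subst (_≤ _) (sym (ℚP.+-identityʳ _)) (lightChild-bound w hw d hc c≤g valid-c heavy IH)

  M-points : EdgesArePoints T M
  M-points = edgesArePoints T A M A-points (proj₁ hpi)

  s-points : ∀ s₀ → s ≡ just s₀ → IsPoint T s₀
  s-points s₀ s≡s₀ = All.lookup A-points (s∈A s₀ s≡s₀)

  crossings≤exitLabels : ∀ w {g ts} → subtreeAt T w ≡ just (node g ts) → ValidHST (node g ts) →
    sum (λ e → [ crossesAtᵇ w e ]· g) M ≤ crossingSum M w (exitLabel (node g ts) w)
  crossings≤exitLabels w {g} {ts} hw valid = sum-mono M (All.map (λ {e} → crossing e) M-points)
    where
      crossing : ∀ e → IsPoint T (proj₁ e) × IsPoint T (proj₂ e) →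
        [ crossesAtᵇ w e ]· g ≤ [ crossesAtᵇ w e ]· (exitLabel (node g ts) w (proj₁ e) + exitLabel (node g ts) w (proj₂ e))
      crossing (p , q) (hp , hq) with crossesAtᵇ w (p , q) in crosses
      ... | false = ℚP.≤-refl
      ... | true = crossing≤exitLabels T w p q hw valid hp hq crosses

  innerCost+outside≤children : ∀ w {g ts} → subtreeAt T w ≡ just (node g ts) → ValidHST (node g ts) →
    innerCost M w + outsideSum M w (exitLabel (node g ts) w)
    ≤ sumFrom (λ i _ → innerCost M (child w i) + outsideSum M (child w i) (exitLabel (node g ts) w)) 0 ts
  innerCost+outside≤children w {g} {ts} hw valid = begin
      innerCost M w + outsideSum M w H
    ≡⟨ cong (_+ outsideSum M w H) (innerCost-children M (proj₁ hpi)) ⟩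
      (inner + sum (λ e → [ crossesAtᵇ w e ]· g) M) + outsideSum M w H
    ≤⟨ ℚP.+-monoˡ-≤ (outsideSum M w H) (ℚP.+-monoʳ-≤ inner (crossings≤exitLabels w hw valid)) ⟩
      (inner + crossingSum M w H) + outsideSum M w H
    ≡⟨ solve 3 (λ a b c → (a :+ b) :+ c := a :+ (c :+ b)) refl inner (crossingSum M w H) (outsideSum M w H) ⟩
      inner + (outsideSum M w H + crossingSum M w H)
    ≡⟨ cong (inner +_) (outsideSum-children M uA (proj₁ hpi) H) ⟩
      inner + sumFrom (λ i _ → outsideSum M (child w i) H) 0 ts
    ≡⟨ sym (sumFrom-⊕ _ _ 0 ts) ⟩
      sumFrom (λ i _ → innerCost M (child w i) + outsideSum M (child w i) H) 0 ts ∎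
    where
      open ℚP.≤-Reasoning
      open +-*-Solver
      open AtNode w hw A-points
      H : Address → ℚ
      H = exitLabel (node g ts) w
      inner : ℚ
      inner = sumFrom (λ i _ → innerCost M (child w i)) 0 ts

  costBound : ∀ n t → height t ℕ.< n → ∀ w → subtreeAt T w ≡ just t → ValidHST t → CostBound t w
  costBound n leaf _ w hw _ rewrite innerCost-leaf M M-points w hw | outsideSum-0 M w | []·-ε (sBelow s w) = ℚP.≤-refl
  costBound (suc n) (node g ts) (s≤s ht<n) w hw valid@(nodeV _ _ below valid-ts) = begin
      (innerCost M w + outsideSum M w H) + heavyOddGapsFrom (weights ts) g w 0 ts
    ≤⟨ ℚP.+-mono-≤ (innerCost+outside≤children w hw valid) (ℚP.≤-reflexive (heavyOddGapsFrom≡sumFrom (weights ts) g w 0 ts)) ⟩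
      sumFrom (λ i _ → innerCost M (child w i) + outsideSum M (child w i) H) 0 ts + sumFrom heavyTerm 0 ts
    ≡⟨ sym (sumFrom-⊕ _ _ 0 ts) ⟩
      sumFrom (λ i c → (innerCost M (child w i) + outsideSum M (child w i) H) + heavyTerm i c) 0 ts
    ≤⟨ sumFrom-mono 0 ts (λ d c hc → child-bound w hw d hc (All.lookup below (nth⇒∈ ts d hc)) (All.lookup valid-ts (nth⇒∈ ts d hc))
                                        (costBound n c (ℕP.<-≤-trans (s≤s (height≤heights ts d hc)) ht<n) (child w d)
                                                   (subtreeAt-child T w d hw hc) (All.lookup valid-ts (nth⇒∈ ts d hc)))) ⟩
      sumFrom (λ i c → gapTerm i c + [ sBelow s (child w i) ]· g) 0 ts
    ≡⟨ sumFrom-⊕ _ _ 0 ts ⟩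
      sumFrom gapTerm 0 ts + sumFrom (λ i _ → [ sBelow s (child w i) ]· g) 0 ts
    ≡⟨ cong₂ _+_ (sym (oddGapsFrom≡sumFrom g w 0 ts)) (sym (sBelow-children T w s hw s-points g)) ⟩
      oddGapsFrom g w 0 ts + [ sBelow s w ]· g ∎
    where
      open ℚP.≤-Reasoning
      H : Address → ℚ
      H = exitLabel (node g ts) w
      heavyTerm gapTerm : ℕ → Tree → ℚ
      heavyTerm i c = [ heavyᵇ (weights ts) c ]· ([ oddBelow (child w i) ]· (g - label c) + heavyOddGaps c (child w i))
      gapTerm i c = [ oddBelowˢ (child w i) ]· (g - label c) + oddGaps c (child w i)

  innerCost-root : ValidHST T → sBelow s [] ≡ oddBelow [] → innerCost M [] ≤ oddGaps T []
  innerCost-root valid s-parity = +-cancelʳ-≤ (innerCost M []) (oddGaps T []) ([ oddBelow [] ]· label T)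
    (subst (λ b → innerCost M [] + [ oddBelow [] ]· label T ≤ oddGaps T [] + [ b ]· label T) s-parity
      (innerCost-top T [] refl valid (root-isHPTop T) (costBound (suc (height T)) T ℕP.≤-refl [] refl valid)))

-- Lower bound through a near-perfect matching that leaves at most s unmatched

module LowerBound (T : Tree) (A : List Address) (s : Maybe Address) (N : Matching)
                  (A-points : All (IsPoint T) A) (uA : Unique A) (mN : IsMatching A N)
                  (s-unmatched : All (λ p → notS s p ≡ true) (endpoints N)) where

  open Cuts T A
  open Potentials A s

  N-points : EdgesArePoints T N
  N-points = edgesArePoints T A N A-points mN

  labelOffS : ℚ → Address → ℚ
  labelOffS x p = [ notS s p ]· x

  oddBelowˢ⇒outside : ∀ w → oddBelowˢ w ≡ true → ∃ λ p → p ∈ A × matchedOutsideᵇ N w p ≡ true × notS s p ≡ true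
  oddBelowˢ⇒outside w odd
    with count-odd⇒∃ (λ a → matchedOutsideᵇ N w a ∧ notS s a) A
           (trans (sym (isOdd-matchedOutside (notS s) A N w uA mN s-unmatched)) odd)
  ... | p , p∈A , out = p , p∈A , ∧-conicalˡ _ _ out , ∧-conicalʳ _ _ out

  outsideTerm-nonneg : ∀ w δ → 0ℚ ≤ δ → All (λ p → 0ℚ ≤ [ matchedOutsideᵇ N w p ]· labelOffS δ p) A
  outsideTerm-nonneg w δ 0≤δ = All.tabulate (λ {p} _ → []·-nonneg (matchedOutsideᵇ N w p) ([]·-nonneg (notS s p) 0≤δ))

  oddGap≤outsideSum : ∀ w δ → 0ℚ ≤ δ → [ oddBelowˢ w ]· δ ≤ outsideSum N w (labelOffS δ)
  oddGap≤outsideSum w δ 0≤δ with oddBelowˢ w in odd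
  ... | false = sum-nonneg A (outsideTerm-nonneg w δ 0≤δ)
  ... | true with oddBelowˢ⇒outside w odd
  ... | p , p∈A , out , p≢s = subst (_≤ outsideSum N w (labelOffS δ)) term≡δ (term≤sum A (outsideTerm-nonneg w δ 0≤δ) p∈A)
    where
      term≡δ : [ matchedOutsideᵇ N w p ]· labelOffS δ p ≡ δ
      term≡δ rewrite out | p≢s = refl

  outsideSum-+ : ∀ w x y → outsideSum N w (labelOffS (x + y)) ≡ outsideSum N w (labelOffS x) + outsideSum N w (labelOffS y)
  outsideSum-+ w x y =
    trans (sum-cong A (λ p → trans (cong ([ matchedOutsideᵇ N w p ]·_) ([]·-⊕ (notS s p) x y))
                                   ([]·-⊕ (matchedOutsideᵇ N w p) _ _)))
          (sum-⊕ _ _ A)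

  crossingSum-offS : ∀ w g →
    crossingSum N w (labelOffS g) ≡ sum (λ e → [ crossesAtᵇ w e ]· g) N + sum (λ e → [ crossesAtᵇ w e ]· g) N
  crossingSum-offS w g = trans (sum-cong-All N (All.map (λ {e} → bothOffS e) (All-endpoints N s-unmatched))) (sum-⊕ _ _ N)
    where
      bothOffS : ∀ e → notS s (proj₁ e) ≡ true × notS s (proj₂ e) ≡ true →
        [ crossesAtᵇ w e ]· (labelOffS g (proj₁ e) + labelOffS g (proj₂ e)) ≡ [ crossesAtᵇ w e ]· g + [ crossesAtᵇ w e ]· g
      bothOffS e (p≢s , q≢s) rewrite p≢s | q≢s = []·-⊕ (crossesAtᵇ w e) g g

  GapBound : Tree → Address → Set
  GapBound t w = oddGaps t w ≤ (innerCost N w + innerCost N w) + outsideSum N w (labelOffS (label t))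

  child-gap-bound : ∀ w g d c → label c ≤ g → GapBound c (child w d) →
    [ oddBelowˢ (child w d) ]· (g - label c) + oddGaps c (child w d)
      ≤ (innerCost N (child w d) + innerCost N (child w d)) + outsideSum N (child w d) (labelOffS g)
  child-gap-bound w g d c c≤g IH = begin
      [ oddBelowˢ wi ]· (g - label c) + oddGaps c wi
    ≤⟨ ℚP.+-mono-≤ (oddGap≤outsideSum wi (g - label c) (0≤y-x c≤g)) IH ⟩
      outsideSum N wi (labelOffS (g - label c)) + ((innerCost N wi + innerCost N wi) + outsideSum N wi (labelOffS (label c)))
    ≡⟨ solve 3 (λ a c b → a :+ (c :+ b) := c :+ (b :+ a)) refl
         (outsideSum N wi (labelOffS (g - label c))) (innerCost N wi + innerCost N wi) (outsideSum N wi (labelOffS (label c))) ⟩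
      (innerCost N wi + innerCost N wi) + (outsideSum N wi (labelOffS (label c)) + outsideSum N wi (labelOffS (g - label c)))
    ≡⟨ cong ((innerCost N wi + innerCost N wi) +_) (sym (outsideSum-+ wi (label c) (g - label c))) ⟩
      (innerCost N wi + innerCost N wi) + outsideSum N wi (labelOffS (label c + (g - label c)))
    ≡⟨ cong (λ x → (innerCost N wi + innerCost N wi) + outsideSum N wi (labelOffS x))
            (solve 2 (λ g l → l :+ (g :- l) := g) refl g (label c)) ⟩
      (innerCost N wi + innerCost N wi) + outsideSum N wi (labelOffS g) ∎
    where
      open ℚP.≤-Reasoning
      open +-*-Solver
      wi : Address
      wi = child w d

  gapBound : ∀ n t → height t ℕ.< n → ∀ w → subtreeAt T w ≡ just t → ValidHST t → GapBound t w
  gapBound n leaf _ w hw _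
    rewrite innerCost-leaf N N-points w hw | outsideSum-cong N w (λ p _ → []·-ε (notS s p)) | outsideSum-0 N w = ℚP.≤-refl
  gapBound (suc n) (node g ts) (s≤s ht<n) w hw (nodeV _ _ below valid-ts) = begin
      oddGapsFrom g w 0 ts
    ≡⟨ oddGapsFrom≡sumFrom g w 0 ts ⟩
      sumFrom (λ i c → [ oddBelowˢ (child w i) ]· (g - label c) + oddGaps c (child w i)) 0 ts
    ≤⟨ sumFrom-mono 0 ts (λ d c hc → child-gap-bound w g d c (All.lookup below (nth⇒∈ ts d hc))
                                        (gapBound n c (ℕP.<-≤-trans (s≤s (height≤heights ts d hc)) ht<n) (child w d)
                                                  (subtreeAt-child T w d hw hc) (All.lookup valid-ts (nth⇒∈ ts d hc)))) ⟩
      sumFrom (λ i _ → (innerCost N (child w i) + innerCost N (child w i)) + outsideSum N (child w i) (labelOffS g)) 0 ts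
    ≡⟨ trans (sumFrom-⊕ _ _ 0 ts) (cong (_+ outside) (sumFrom-⊕ _ _ 0 ts)) ⟩
      (inner + inner) + outside
    ≡⟨ cong ((inner + inner) +_) (sym (outsideSum-children N uA mN (labelOffS g))) ⟩
      (inner + inner) + (outsideSum N w (labelOffS g) + crossingSum N w (labelOffS g))
    ≡⟨ cong (λ x → (inner + inner) + (outsideSum N w (labelOffS g) + x)) (crossingSum-offS w g) ⟩
      (inner + inner) + (outsideSum N w (labelOffS g) + (crossing + crossing))
    ≡⟨ solve 3 (λ c m x → (c :+ c) :+ (m :+ (x :+ x)) := ((c :+ x) :+ (c :+ x)) :+ m) refl
               inner (outsideSum N w (labelOffS g)) crossing ⟩
      ((inner + crossing) + (inner + crossing)) + outsideSum N w (labelOffS g)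
    ≡⟨ cong (λ x → (x + x) + outsideSum N w (labelOffS g)) (sym (innerCost-children N mN)) ⟩
      (innerCost N w + innerCost N w) + outsideSum N w (labelOffS g) ∎
    where
      open ℚP.≤-Reasoning
      open +-*-Solver
      open AtNode w hw A-points
      inner crossing outside : ℚ
      inner = sumFrom (λ i _ → innerCost N (child w i)) 0 ts
      crossing = sum (λ e → [ crossesAtᵇ w e ]· g) N
      outside = sumFrom (λ i _ → outsideSum N (child w i) (labelOffS g)) 0 ts

  innerCost-lower-root : ValidHST T → (∀ {p} → p ∈ A → (matchedOutsideᵇ N [] p ∧ notS s p) ≡ false) →
    oddGaps T [] ≤ innerCost N [] + innerCost N []
  innerCost-lower-root valid only-s = subst (oddGaps T [] ≤_)
    (trans (cong (innerCost N [] + innerCost N [] +_) outside≡0) (ℚP.+-identityʳ _))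
    (gapBound (suc (height T)) T ℕP.≤-refl [] refl valid)
    where
      outside≡0 : outsideSum N [] (labelOffS (label T)) ≡ 0ℚ
      outside≡0 = sum-ε A (All.tabulate (λ {p} p∈A →
        trans (sym ([∧]· (matchedOutsideᵇ N [] p) (notS s p) (label T))) (cong ([_]· label T) (only-s p∈A))))

-- The point left unmatched by a near-perfect matching

findᵇ-sound : {X : Set} (f : X → Bool) (xs : List X) {x : X} → findᵇ f xs ≡ just x → x ∈ xs × f x ≡ true
findᵇ-sound f (a ∷ xs) found with f a in fa
findᵇ-sound f (a ∷ xs) refl | true = here refl , fa
... | false = let x∈xs , fx = findᵇ-sound f xs found in there x∈xs , fx

findᵇ-complete : {X : Set} (f : X → Bool) (xs : List X) {x : X} → x ∈ xs → f x ≡ true → ∃ λ y → findᵇ f xs ≡ just y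
findᵇ-complete f (a ∷ xs) x∈xs fx with f a in fa
... | true = a , refl
findᵇ-complete f (a ∷ xs) (here refl) fx | false = case trans (sym fa) fx of λ ()
findᵇ-complete f (a ∷ xs) (there x∈xs) fx | false = findᵇ-complete f xs x∈xs fx

endpoint-partnered : ∀ X x → x ∈ endpoints X → partnerInsideᵇ X [] x ≡ true
endpoint-partnered ((a , b) ∷ X) x (here refl) rewrite ==ᴬ-refl x = refl
endpoint-partnered ((a , b) ∷ X) x (there (here refl)) rewrite ==ᴬ-refl x | ∨-zeroʳ ((a ==ᴬ x) ∧ true) = refl
endpoint-partnered ((a , b) ∷ X) x (there (there x∈X)) rewrite endpoint-partnered X x x∈X = ∨-zeroʳ _

outside-root⇒∉endpoints : ∀ X x → matchedOutsideᵇ X [] x ≡ true → x ∉ endpoints X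
outside-root⇒∉endpoints X x out x∈X with () ← trans (sym out) (cong not (endpoint-partnered X x x∈X))

count-none : ∀ (f : Address → Bool) A → (∀ {a} → a ∈ A → f a ≡ false) → count f A ≡ 0
count-none f [] _ = refl
count-none f (a ∷ A) none rewrite filterᵇ-∷ f a A | none (here refl) = count-none f A (none ∘ there)

xor≡false⇒≡ : ∀ a b → a xor b ≡ false → a ≡ b
xor≡false⇒≡ false b b≡false = sym b≡false
xor≡false⇒≡ true true _ = refl

module Unmatched (A : List Address) (uA : Unique A) (N : Matching) (nearPerfect : IsNearPerfect A N) where

  -- matched outside the root means unmatched
  s : Maybe Address
  s = findᵇ (matchedOutsideᵇ N []) A

  open Potentials A s

  s∈A : ∀ s₀ → s ≡ just s₀ → s₀ ∈ A
  s∈A s₀ found = proj₁ (findᵇ-sound _ A found)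

  outside-root⇒s : ∀ {p} → p ∈ A → matchedOutsideᵇ N [] p ≡ true → s ≡ just p
  outside-root⇒s {p} p∈A out with findᵇ-complete _ A p∈A out
  ... | s₀ , found = trans found (cong just (proj₂ nearPerfect s₀ p (s∈A s₀ found) p∈A
                       (outside-root⇒∉endpoints N s₀ (proj₂ (findᵇ-sound _ A found))) (outside-root⇒∉endpoints N p out)))

  s-unmatched : All (λ p → notS s p ≡ true) (endpoints N)
  s-unmatched = All.tabulate notS-endpoint
    where
      notS-endpoint : ∀ {p} → p ∈ endpoints N → notS s p ≡ true
      notS-endpoint {p} p∈N with s in found
      ... | nothing = refl
      ... | just s₀ = cong not (dec-false (p ≟ᴬ s₀) λ where
              refl → outside-root⇒∉endpoints N p (proj₂ (findᵇ-sound _ A found)) p∈N)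

  only-s-outside-root : ∀ {p} → p ∈ A → (matchedOutsideᵇ N [] p ∧ notS s p) ≡ false
  only-s-outside-root {p} p∈A with matchedOutsideᵇ N [] p in out
  ... | false = refl
  ... | true rewrite outside-root⇒s p∈A out = cong not (==ᴬ-refl p)

  sBelow-root : sBelow s [] ≡ oddBelow []
  sBelow-root = xor≡false⇒≡ (sBelow s []) (oddBelow []) (begin
      sBelow s [] xor oddBelow []                                ≡⟨ sym (isOdd-without-s A s uA s∈A []) ⟩
      oddBelowˢ []                                               ≡⟨ isOdd-matchedOutside (notS s) A N [] uA (proj₁ nearPerfect)
                                                                      s-unmatched ⟩
      isOdd (count (λ a → matchedOutsideᵇ N [] a ∧ notS s a) A)  ≡⟨ cong isOdd (count-none _ A only-s-outside-root) ⟩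
      false                                                      ∎)
    where open ≡-Reasoning

lemma9p3 : (T : Tree) → ValidHST T → (A : List Address) → Unique A
    → All (IsPoint T) A → (M Mopt : Matching) → HPInward T A M
    → IsOptNearPerfect T A Mopt → Cost T M ≤ Cost T Mopt + Cost T Mopt
lemma9p3 T valid A uA A-points M Mopt hpi (nearPerfect , _) = begin
    Cost T M                                ≡⟨ Cost≡innerCost-root M ⟩
    innerCost M []                          ≤⟨ UpperBound.innerCost-root T A s M A-points uA s∈A hpi valid sBelow-root ⟩
    oddGaps T []                            ≤⟨ LowerBound.innerCost-lower-root T A s Mopt A-points uA (proj₁ nearPerfect)
                                                 s-unmatched valid only-s-outside-root ⟩
    innerCost Mopt [] + innerCost Mopt []   ≡⟨ sym (cong₂ _+_ (Cost≡innerCost-root Mopt) (Cost≡innerCost-root Mopt)) ⟩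
    Cost T Mopt + Cost T Mopt               ∎
  where
    open ℚP.≤-Reasoning
    open Cuts T A
    open Unmatched A uA Mopt nearPerfect
    open Potentials A s
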